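{- Let $(b,a,c)$ be a Markov triple in which $a$ is the largest entry, $q$ an integer with $q\equiv 3cb^{ -1}\pmod a$, $b_0=b$, $c_0=c$, $b_{n+1}=c_n$, $c_{n+1}=3ac_n-b_n$. For $n\in\mathbb{N}$ let $\Delta_n^a$ be the triangle with vertices $(0,0)$, $\big(\frac{c_n}{ab_n},0\big)$, $\big(\frac{(aq-1)b_n}{ac_n},\frac{ab_n}{c_n}\big)$, and let $\Delta_\infty^a$ be the triangle with vertices $(0,0)$, $(\lambda(a),0)$, $\frac{1}{a^2\lambda(a)}(aq-1,a^2)$, where $\lambda(a)=\frac{3+\sqrt{9-4/a^2}}{2}$. Then for every $t\in\mathbb{N}$ there exists $N_t\in\mathbb{N}$ such that $t\Delta_\infty^a\cap\mathbb{Z}^2=t\Delta_n^a\cap\mathbb{Z}^2$ for all $n\ge N_t$.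
   Context: A Markov triple is a triple of positive integers $(p_1,p_2,p_3)$ with $p_1^2+p_2^2+p_3^2=3p_1p_2p_3$; its entries are pairwise coprime. $t\Delta$ denotes the dilate $\{tx:x\in\Delta\}$. -}

module Defs where

open import Data.Nat as ℕ using (ℕ; zero; suc)
open import Data.Integer as ℤ using (ℤ; +_; +[1+_]; -[1+_])
open import Data.Rational as ℚ using (ℚ; mkℚ; 0ℚ; 1/_; _/_)
open import Data.Product using (Σ; ∃; _×_; _,_; proj₁; proj₂)
open import Data.Sum using (_⊎_)
open import Relation.Binary.PropositionalEquality using (_≡_)

IsMarkovTriple : ℕ → ℕ → ℕ → Set
IsMarkovTriple p₁ p₂ p₃ =
  (0 ℕ.< p₁) × (0 ℕ.< p₂) × (0 ℕ.< p₃) ×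
  (p₁ ℕ.* p₁ ℕ.+ p₂ ℕ.* p₂ ℕ.+ p₃ ℕ.* p₃ ≡ 3 ℕ.* p₁ ℕ.* p₂ ℕ.* p₃)

bcSeq : (a b c : ℤ) → ℕ → ℤ × ℤ
bcSeq a b c zero    = b , c
bcSeq a b c (suc n) =
  let bn = proj₁ (bcSeq a b c n) ; cn = proj₂ (bcSeq a b c n)
  in cn , (ℤ.+ 3 ℤ.* a ℤ.* cn ℤ.- bn)

bSeq cSeq : (a b c : ℤ) → ℕ → ℤ
bSeq a b c n = proj₁ (bcSeq a b c n)
cSeq a b c n = proj₂ (bcSeq a b c n)

-- Rationals: embedding of ℤ and a total inverse (inv 0 = 0; only ever
-- applied to nonzero arguments below)

fromℤ : ℤ → ℚ
fromℤ z = z / 1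

invℚ : ℚ → ℚ
invℚ (mkℚ (+ zero) d c)   = 0ℚ
invℚ p@(mkℚ +[1+ n ] d c) = 1/ p
invℚ p@(mkℚ -[1+ n ] d c) = 1/ p

-- The real quadratic field ℚ(√D) ⊂ ℝ, elements u + v √D stored as
-- pairs (u , v).  Used for D = 9a² - 4, which is not a perfect square,
-- so this is a subfield of ℝ with √D > 0 and the order below is the
-- order of ℝ.

QF : Set
QF = ℚ × ℚ

module QField (D : ℚ) where

  emb : ℚ → QF
  emb r = r , 0ℚ

  _⊕_ : QF → QF → QF
  (u , v) ⊕ (u' , v') = (u ℚ.+ u') , (v ℚ.+ v')

  ⊝_ : QF → QF
  ⊝ (u , v) = ℚ.- u , ℚ.- v

  _⊗_ : QF → QF → QF
  (u , v) ⊗ (u' , v') = (u ℚ.* u' ℚ.+ D ℚ.* v ℚ.* v') , (u ℚ.* v' ℚ.+ v ℚ.* u')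

  -- (u + v√D)⁻¹ = (u - v√D) / (u² - D v²)   (total; inverse of 0 is 0)
  inv : QF → QF
  inv (u , v) = let n = invℚ (u ℚ.* u ℚ.- D ℚ.* v ℚ.* v)
                in (u ℚ.* n) , (ℚ.- v ℚ.* n)

  -- u + v √D ≥ 0 in ℝ (with √D ≥ 0)
  NonNeg : QF → Set
  NonNeg (u , v) =
      (0ℚ ℚ.≤ u × 0ℚ ℚ.≤ v)
    ⊎ (0ℚ ℚ.≤ u × v ℚ.< 0ℚ × D ℚ.* v ℚ.* v ℚ.≤ u ℚ.* u)
    ⊎ (u ℚ.< 0ℚ × 0ℚ ℚ.< v × u ℚ.* u ℚ.≤ D ℚ.* v ℚ.* v)

  _≤ₖ_ : QF → QF → Set
  x ≤ₖ y = NonNeg (y ⊕ (⊝ x))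

  Pt : Set
  Pt = QF × QF

  _·_ : QF → Pt → Pt
  s · (x , y) = (s ⊗ x) , (s ⊗ y)

  _+ₚ_ : Pt → Pt → Pt
  (x , y) +ₚ (x' , y') = (x ⊕ x') , (y ⊕ y')

  InTriangle : Pt → Pt → Pt → Pt → Set
  InTriangle v₀ v₁ v₂ X =
    Σ QF λ α → Σ QF λ β → Σ QF λ γ →
      NonNeg α × NonNeg β × NonNeg γ ×
      (α ⊕ (β ⊕ γ) ≡ emb (fromℤ (+ 1))) ×
      (X ≡ ((α · v₀) +ₚ ((β · v₁) +ₚ (γ · v₂))))

  InDilate : ℕ → (Pt → Set) → Pt → Set
  InDilate t Δ X = Σ Pt λ Y → Δ Y × (X ≡ (emb (fromℤ (+ t)) · Y))

  latticePt : ℤ → ℤ → Pt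
  latticePt x y = emb (fromℤ x) , emb (fromℤ y)

Dof : ℕ → ℚ
Dof a = fromℤ (+ (9 ℕ.* a ℕ.* a) ℤ.- + 4)

module Triangles (a b c : ℕ) (q : ℤ) where
  open QField (Dof a) public

  A : ℚ
  A = fromℤ (+ a)

  -- λ(a) = (3 + √(9 - 4/a²))/2 = 3/2 + (1/(2a)) √(9a² - 4)
  lam : QF
  lam = (fromℤ (+ 3) ℚ.* invℚ (fromℤ (+ 2))) , invℚ (fromℤ (+ 2) ℚ.* A)

  origin : Pt
  origin = emb 0ℚ , emb 0ℚ

  bn cn : ℕ → ℚ
  bn n = fromℤ (bSeq (+ a) (+ b) (+ c) n)
  cn n = fromℤ (cSeq (+ a) (+ b) (+ c) n)

  aq-1 : ℚ
  aq-1 = fromℤ (+ a ℤ.* q ℤ.- + 1)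

  Δn : ℕ → Pt → Set
  Δn n = InTriangle origin
           (emb (cn n ℚ.* invℚ (A ℚ.* bn n)) , emb 0ℚ)
           ( emb (aq-1 ℚ.* bn n ℚ.* invℚ (A ℚ.* cn n))
           , emb (A ℚ.* bn n ℚ.* invℚ (cn n)))

  Δ∞ : Pt → Set
  Δ∞ = InTriangle origin
         (lam , emb 0ℚ)
         (inv (emb (A ℚ.* A) ⊗ lam) · (emb aq-1 , emb (A ℚ.* A)))

module Submission where

-- Let D = 9a² − 4 and θ = (3a − √D)/2.  In Δ∞ and in Δₙ the abscissa of
-- the second vertex times the height of the third vertex is 1, so t times the barycentric
-- coordinates of a point are linear forms in it.  At a lattice point (x , y) two of them are, up
-- to positive factors, y and U = a²x − (aq − 1)y for both triangles.  The third is, up to a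
-- positive factor, X − θm with X = a(t − 3y) and m = U − y for Δ∞, and
-- t a bₙ cₙ − U bₙ² − y cₙ² = a²y + bₙ (X cₙ − m bₙ) for Δₙ, by the Markov equation
-- bₙ² + cₙ² + a² = 3a bₙ cₙ.  When y , U ≥ 0 either third condition forces U + y ≤ 3a²t, and then
-- X − θm and X cₙ − m bₙ have the same sign as soon as cₙ > a²|m|: the product of X cₙ − m bₙ
-- and X cₙ − m (3a cₙ − bₙ) is cₙ² (X − θm)(X − θ′m) + a²m² with θ′ = 3a − θ, where the norm
-- (X − θm)(X − θ′m) is an integer.  Since bₙ ≥ n, this is the case for n > 3a⁴t.

open import Defs
open import Data.Nat as ℕ using (ℕ; zero; suc; z≤n; s≤s)
open import Data.Integer as ℤ using (ℤ)
open import Data.Rational as ℚ using (ℚ)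
open import Data.Product using (_×_; _,_)
open import Data.Sum using (_⊎_; inj₁; inj₂)
open import Function.Bundles using (_⇔_; mk⇔)
import Function.Properties.Equivalence as ⇔
open import Relation.Binary.PropositionalEquality

module Positivity where

  open import Data.Integer using (+_; 0ℤ; 1ℤ; _+_; _*_; _-_; -_; _≤_; _<_)
  import Data.Integer.Properties as ℤP
  open import Data.Integer.Tactic.RingSolver using (solve-∀)
  open import Data.Empty using (⊥)

  private variable i j : ℤ

  0≤+ : ∀ n → 0ℤ ≤ + n
  0≤+ n = ℤ.+≤+ z≤n

  0<+ : ∀ n → 0ℤ < + suc n
  0<+ n = ℤ.+<+ (s≤s z≤n)

  +-nonNeg : 0ℤ ≤ i → 0ℤ ≤ j → 0ℤ ≤ i + j
  +-nonNeg = ℤP.+-mono-≤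

  +-pos : 0ℤ < i → 0ℤ ≤ j → 0ℤ < i + j
  +-pos = ℤP.+-mono-<-≤

  *-nonNeg : 0ℤ ≤ i → 0ℤ ≤ j → 0ℤ ≤ i * j
  *-nonNeg {i} {j} 0≤i 0≤j =
    subst (_≤ i * j) (ℤP.*-zeroʳ i) (ℤP.*-monoˡ-≤-nonNeg i {{ℤ.nonNegative 0≤i}} 0≤j)

  *-pos : 0ℤ < i → 0ℤ < j → 0ℤ < i * j
  *-pos {i} {j} 0<i 0<j =
    subst (_< i * j) (ℤP.*-zeroʳ i) (ℤP.*-monoˡ-<-pos i {{ℤ.positive 0<i}} 0<j)

  *-cancelˡ-nonNeg : 0ℤ < i → 0ℤ ≤ i * j → 0ℤ ≤ j
  *-cancelˡ-nonNeg {i} {j} 0<i 0≤ij =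
    ℤP.*-cancelˡ-≤-pos 0ℤ j i {{ℤ.positive 0<i}} (subst (_≤ i * j) (sym (ℤP.*-zeroʳ i)) 0≤ij)

  *-cancelˡ-pos : 0ℤ ≤ i → 0ℤ < i * j → 0ℤ < j
  *-cancelˡ-pos {i} {j} 0≤i 0<ij =
    ℤP.*-cancelˡ-<-nonNeg i {{ℤ.nonNegative 0≤i}} (subst (_< i * j) (sym (ℤP.*-zeroʳ i)) 0<ij)

  neg-pos : i < 0ℤ → 0ℤ < - i
  neg-pos = ℤP.neg-mono-<

  nonNeg-by : i ≡ j → 0ℤ ≤ j → 0ℤ ≤ i
  nonNeg-by i≡j = subst (0ℤ ≤_) (sym i≡j)

  pos-by : i ≡ j → 0ℤ < j → 0ℤ < i
  pos-by i≡j = subst (0ℤ <_) (sym i≡j)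

  <0⇒0≤-i-1 : i < 0ℤ → 0ℤ ≤ - i - 1ℤ
  <0⇒0≤-i-1 {i} i<0 = nonNeg-by (regroup i) (ℤP.i≤j⇒0≤j-i (ℤP.i<j⇒suc[i]≤j i<0))
    where
    regroup : ∀ i → - i - 1ℤ ≡ 0ℤ - (1ℤ + i)
    regroup = solve-∀

  <⇒0<j-i : i < j → 0ℤ < j - i
  <⇒0<j-i {i} {j} i<j = subst (_< j - i) (ℤP.+-inverseʳ i) (ℤP.+-monoˡ-< (- i) i<j)

  0<j-i⇒< : ∀ i {j} → 0ℤ < j - i → i < j
  0<j-i⇒< i {j} 0<j-i = subst₂ _<_ (ℤP.+-identityˡ i) (cancel j i) (ℤP.+-monoˡ-< i 0<j-i)
    where
    cancel : ∀ j i → (j - i) + i ≡ j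
    cancel = solve-∀

  i≡[i-j]+j : ∀ i j → i ≡ (i - j) + j
  i≡[i-j]+j = solve-∀

  nonNeg-neg-pos⊥ : 0ℤ ≤ i → 0ℤ < - i → ⊥
  nonNeg-neg-pos⊥ 0≤i 0<-i = ℤP.<⇒≱ 0<-i (ℤP.neg-mono-≤ 0≤i)

  pos-nonNeg-neg⊥ : 0ℤ < i → 0ℤ ≤ - i → ⊥
  pos-nonNeg-neg⊥ 0<i 0≤-i = ℤP.<⇒≱ 0<i (subst (_≤ 0ℤ) (ℤP.neg-involutive _) (ℤP.neg-mono-≤ 0≤-i))

module QuadraticIntegers where

  open import Data.Integer using (+_; 0ℤ; 1ℤ; _+_; _*_; _-_; -_; _≤_; _<_)
  import Data.Integer.Properties as ℤP
  open import Data.Integer.Tactic.RingSolver using (solve-∀)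
  open import Relation.Binary.Definitions using (tri<; tri≈; tri>)
  open import Relation.Nullary using (yes; no)
  open import Relation.Nullary.Negation using (contradiction)
  open Positivity

  -- P + R √D ≥ 0, as NonNeg in Defs but with integer coordinates
  NonNegℤ√ : ℤ → ℤ → ℤ → Set
  NonNegℤ√ D P R =
      (0ℤ ≤ P × 0ℤ ≤ R)
    ⊎ (0ℤ ≤ P × R < 0ℤ × D * R * R ≤ P * P)
    ⊎ (P < 0ℤ × 0ℤ < R × P * P ≤ D * R * R)

  -- For P = 2X − 3am, NonNegℤ√ D P m says X − θm ≥ 0 with θ = (3a − √D)/2, while M = XC − mB is
  -- C (X − (B/C) m), where B/C lies just above θ.  Each inequality comes from an identity writing
  -- it as a sum of products of quantities already known to be nonnegative.
  module Approximation (a B C : ℤ) (1≤a : 1ℤ ≤ a) (0<B : 0ℤ < B) (B≤C : B ≤ C)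
                       (markov : B * B + C * C + a * a ≡ + 3 * a * B * C) where

    private
      norm-identity : ∀ a X m →
        let P = + 2 * X - + 3 * a * m; Q = X * X - + 3 * a * X * m + m * m in
        P * P - (+ 9 * a * a - + 4) * m * m ≡ + 4 * Q
      norm-identity = solve-∀

      conorm-identity : ∀ a X m →
        let P = + 2 * X - + 3 * a * m; Q = X * X - + 3 * a * X * m + m * m in
        (+ 9 * a * a - + 4) * m * m - P * P ≡ + 4 * (- Q)
      conorm-identity = solve-∀

      product-identity : ∀ a B C X m →
        let Q = X * X - + 3 * a * X * m + m * m
            M = X * C - m * B; M* = X * C - m * (+ 3 * a * C - B) in
        M * M* ≡ C * C * Q + a * a * m * m - m * m * (B * B + C * C + a * a - + 3 * a * B * C)
      product-identity = solve-∀

      twice-M : ∀ a B C X m →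
        + 2 * (X * C - m * B) ≡ C * (+ 2 * X - + 3 * a * m) + m * (+ 3 * a * C - + 2 * B)
      twice-M = solve-∀

      twice-M* : ∀ a B C X m →
        + 2 * (X * C - m * (+ 3 * a * C - B)) ≡ C * (+ 2 * X - + 3 * a * m) + (- m) * (+ 3 * a * C - + 2 * B)
      twice-M* = solve-∀

      twice-neg-M* : ∀ a B C X m →
        + 2 * (- (X * C - m * (+ 3 * a * C - B))) ≡ C * (- (+ 2 * X - + 3 * a * m)) + m * (+ 3 * a * C - + 2 * B)
      twice-neg-M* = solve-∀

      C*P-identity : ∀ a B C X m →
        C * (+ 2 * X - + 3 * a * m) ≡ + 2 * (X * C - m * B) + (- m) * (+ 3 * a * C - + 2 * B)
      C*P-identity = solve-∀

      gap-identity : ∀ a B C → + 3 * a * C - + 2 * B - C ≡ + 3 * (a - 1ℤ) * C + + 2 * (C - B)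
      gap-identity = solve-∀

      neg-M*-identity : ∀ a B C X m →
        - (X * C - m * (+ 3 * a * C - B)) ≡ - (X * C - m * B) + m * (+ 3 * a * C - + 2 * B)
      neg-M*-identity = solve-∀

      product-excess-identity : ∀ a B C X m →
        let M = X * C - m * B; M* = X * C - m * (+ 3 * a * C - B) in
        M * M* - m * C ≡ (- M - 1ℤ) * (- M*) + (- M + m * ((+ 3 * a * C - + 2 * B) - C))
      product-excess-identity = solve-∀

      product-deficit-identity : ∀ a C Q m →
        m * C - (C * C * Q + a * a * m * m) ≡ C * C * (- Q) + m * (C - a * a * m)
      product-deficit-identity = solve-∀

      negative-product-identity : ∀ a C Q m →
        - (C * C * Q + a * a * m * m) ≡ (C - a * (- m)) * (C + a * (- m)) + C * C * (- Q - 1ℤ)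
      negative-product-identity = solve-∀

      split-identity : ∀ a C m → C - a * (- m) ≡ (C - a * a * (- m)) + (a - 1ℤ) * a * (- m)
      split-identity = solve-∀

      square-of-neg : ∀ a m → a * a * m * m ≡ (a * (- m)) * (a * (- m))
      square-of-neg = solve-∀

      square : ∀ a m → a * a * m * m ≡ (a * m) * (a * m)
      square = solve-∀

    D : ℤ
    D = + 9 * a * a - + 4

    0<a : 0ℤ < a
    0<a = ℤP.<-≤-trans (0<+ 0) 1≤a

    0<C : 0ℤ < C
    0<C = ℤP.<-≤-trans 0<B B≤C

    0≤C : 0ℤ ≤ C
    0≤C = ℤP.<⇒≤ 0<C

    0<C*C : 0ℤ < C * C
    0<C*C = *-pos 0<C 0<C

    drop-markov : ∀ x k → x - k * (B * B + C * C + a * a - + 3 * a * B * C) ≡ x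
    drop-markov x k = begin
      x - k * (B * B + C * C + a * a - + 3 * a * B * C) ≡⟨ cong (λ z → x - k * z) (ℤP.i≡j⇒i-j≡0 markov) ⟩
      x - k * 0ℤ                                        ≡⟨ cong (λ z → x - z) (ℤP.*-zeroʳ k) ⟩
      x - 0ℤ                                            ≡⟨ ℤP.+-identityʳ x ⟩
      x                                                 ∎
      where open ≡-Reasoning

    gap : ℤ
    gap = + 3 * a * C - + 2 * B

    0≤gap-C : 0ℤ ≤ gap - C
    0≤gap-C = nonNeg-by (gap-identity a B C)
      (+-nonNeg (*-nonNeg (*-nonNeg (0≤+ 3) (ℤP.i≤j⇒0≤j-i 1≤a)) 0≤C)
                (*-nonNeg (0≤+ 2) (ℤP.i≤j⇒0≤j-i B≤C)))

    0<gap : 0ℤ < gap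
    0<gap = pos-by (i≡[i-j]+j gap C) (ℤP.+-mono-≤-< 0≤gap-C 0<C)

    module _ (X m : ℤ) where

      P Q M M* : ℤ
      P  = + 2 * X - + 3 * a * m
      Q  = X * X - + 3 * a * X * m + m * m
      M  = X * C - m * B
      M* = X * C - m * (+ 3 * a * C - B)

      M*M*≡ : M * M* ≡ C * C * Q + a * a * m * m
      M*M*≡ = trans (product-identity a B C X m) (drop-markov (C * C * Q + a * a * m * m) (m * m))

      0≤Q : D * m * m ≤ P * P → 0ℤ ≤ Q
      0≤Q Dmm≤PP = *-cancelˡ-nonNeg (0<+ 3) (nonNeg-by (sym (norm-identity a X m)) (ℤP.i≤j⇒0≤j-i Dmm≤PP))

      0≤-Q : P * P ≤ D * m * m → 0ℤ ≤ - Q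
      0≤-Q PP≤Dmm = *-cancelˡ-nonNeg (0<+ 3) (nonNeg-by (sym (conorm-identity a X m)) (ℤP.i≤j⇒0≤j-i PP≤Dmm))

      Dmm≤PP : 0ℤ ≤ Q → D * m * m ≤ P * P
      Dmm≤PP 0≤Q = ℤP.0≤i-j⇒j≤i (nonNeg-by (norm-identity a X m) (*-nonNeg (0≤+ 4) 0≤Q))

      PP≤Dmm : 0ℤ ≤ - Q → P * P ≤ D * m * m
      PP≤Dmm 0≤-Q = ℤP.0≤i-j⇒j≤i (nonNeg-by (conorm-identity a X m) (*-nonNeg (0≤+ 4) 0≤-Q))

      0≤P : 0ℤ ≤ M → 0ℤ ≤ - m → 0ℤ ≤ P
      0≤P 0≤M 0≤-m = *-cancelˡ-nonNeg 0<C (nonNeg-by (C*P-identity a B C X m)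
        (+-nonNeg (*-nonNeg (0≤+ 2) 0≤M) (*-nonNeg 0≤-m (ℤP.<⇒≤ 0<gap))))

      nonNeg√⇒nonNeg : a * a * m < C → NonNegℤ√ D P m → 0ℤ ≤ M
      nonNeg√⇒nonNeg _ (inj₁ (0≤P , 0≤m)) = *-cancelˡ-nonNeg (0<+ 1) (nonNeg-by (twice-M a B C X m)
        (+-nonNeg (*-nonNeg 0≤C 0≤P) (*-nonNeg 0≤m (ℤP.<⇒≤ 0<gap))))
      nonNeg√⇒nonNeg _ (inj₂ (inj₁ (0≤P , m<0 , Dmm≤PP))) = ℤP.<⇒≤ (*-cancelˡ-pos (ℤP.<⇒≤ 0<M*) 0<M*M)
        where
        0<-m = neg-pos m<0
        0<M* : 0ℤ < M*
        0<M* = *-cancelˡ-pos (0≤+ 2) (pos-by (twice-M* a B C X m)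
          (ℤP.+-mono-≤-< (*-nonNeg 0≤C 0≤P) (*-pos 0<-m 0<gap)))
        0<M*M : 0ℤ < M* * M
        0<M*M = pos-by (trans (ℤP.*-comm M* M) M*M*≡)
          (ℤP.+-mono-≤-< (*-nonNeg (ℤP.<⇒≤ 0<C*C) (0≤Q Dmm≤PP))
                         (pos-by (square-of-neg a m) (*-pos (*-pos 0<a 0<-m) (*-pos 0<a 0<-m))))
      nonNeg√⇒nonNeg a²m<C (inj₂ (inj₂ (P<0 , 0<m , PP≤Dmm))) with 0ℤ ℤP.≤? M
      ... | yes 0≤M = 0≤M
      ... | no M≱0 = contradiction (0<j-i⇒< (m * C) mC<MM*) (ℤP.<-asym (0<j-i⇒< (M * M*) MM*<mC))
        where
        M<0 = ℤP.≰⇒> M≱0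
        MM*<mC : 0ℤ < m * C - M * M*
        MM*<mC = pos-by (trans (cong (λ e → m * C - e) M*M*≡) (product-deficit-identity a C Q m))
          (ℤP.+-mono-≤-< (*-nonNeg (ℤP.<⇒≤ 0<C*C) (0≤-Q PP≤Dmm)) (*-pos 0<m (<⇒0<j-i a²m<C)))
        mC<MM* : 0ℤ < M * M* - m * C
        mC<MM* = pos-by (product-excess-identity a B C X m)
          (ℤP.+-mono-≤-< (*-nonNeg (<0⇒0≤-i-1 M<0)
                                   (nonNeg-by (neg-M*-identity a B C X m)
                                     (+-nonNeg (ℤP.<⇒≤ (neg-pos M<0)) (*-nonNeg (ℤP.<⇒≤ 0<m) (ℤP.<⇒≤ 0<gap)))))
                         (+-pos (neg-pos M<0) (*-nonNeg (ℤP.<⇒≤ 0<m) 0≤gap-C)))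

      nonNeg⇒nonNeg√ : a * a * (- m) < C → 0ℤ ≤ M → NonNegℤ√ D P m
      nonNeg⇒nonNeg√ a²[-m]<C 0≤M with ℤP.<-cmp m 0ℤ
      ... | tri≈ _ refl _ = inj₁ (0≤P 0≤M ℤP.≤-refl , ℤP.≤-refl)
      ... | tri< m<0 _ _ = inj₂ (inj₁ (0≤P′ , m<0 , Dmm≤PP 0≤Q′))
        where
        0≤-m = ℤP.<⇒≤ (neg-pos m<0)
        0≤P′ = 0≤P 0≤M 0≤-m
        0≤Q′ : 0ℤ ≤ Q
        0≤Q′ with 0ℤ ℤP.≤? Q
        ... | yes 0≤Q = 0≤Q
        ... | no Q≱0 = contradiction MM*<0 (nonNeg-neg-pos⊥ (*-nonNeg 0≤M 0≤M*))
          where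
          0≤M* : 0ℤ ≤ M*
          0≤M* = *-cancelˡ-nonNeg (0<+ 1) (nonNeg-by (twice-M* a B C X m)
            (+-nonNeg (*-nonNeg 0≤C 0≤P′) (*-nonNeg 0≤-m (ℤP.<⇒≤ 0<gap))))
          0<C-a[-m] : 0ℤ < C - a * (- m)
          0<C-a[-m] = pos-by (split-identity a C m)
            (+-pos (<⇒0<j-i a²[-m]<C) (*-nonNeg (*-nonNeg (ℤP.i≤j⇒0≤j-i 1≤a) (ℤP.<⇒≤ 0<a)) 0≤-m))
          MM*<0 : 0ℤ < - (M * M*)
          MM*<0 = pos-by (trans (cong -_ M*M*≡) (negative-product-identity a C Q m))
            (+-pos (*-pos 0<C-a[-m] (+-pos 0<C (*-nonNeg (ℤP.<⇒≤ 0<a) 0≤-m)))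
                   (*-nonNeg (ℤP.<⇒≤ 0<C*C) (<0⇒0≤-i-1 (ℤP.≰⇒> Q≱0))))
      ... | tri> _ _ 0<m with 0ℤ ℤP.≤? P
      ...   | yes 0≤P′ = inj₁ (0≤P′ , ℤP.<⇒≤ 0<m)
      ...   | no P≱0 = inj₂ (inj₂ (P<0 , 0<m , PP≤Dmm 0≤-Q′))
        where
        P<0 = ℤP.≰⇒> P≱0
        0≤-Q′ : 0ℤ ≤ - Q
        0≤-Q′ with Q ℤP.≤? 0ℤ
        ... | yes Q≤0 = ℤP.neg-mono-≤ Q≤0
        ... | no Q≰0 = contradiction (nonNeg-by (ℤP.neg-distribʳ-* M M*) (*-nonNeg 0≤M 0≤-M*)) (pos-nonNeg-neg⊥ 0<MM*)
          where
          0≤-M* : 0ℤ ≤ - M*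
          0≤-M* = *-cancelˡ-nonNeg (0<+ 1) (nonNeg-by (twice-neg-M* a B C X m)
            (+-nonNeg (*-nonNeg 0≤C (ℤP.<⇒≤ (neg-pos P<0))) (*-nonNeg (ℤP.<⇒≤ 0<m) (ℤP.<⇒≤ 0<gap))))
          0<MM* : 0ℤ < M * M*
          0<MM* = pos-by M*M*≡ (ℤP.+-mono-<-≤ (*-pos 0<C*C (ℤP.≰⇒> Q≰0))
            (nonNeg-by (square a m) (*-nonNeg (ℤP.<⇒≤ 0<am) (ℤP.<⇒≤ 0<am))))
            where 0<am = *-pos 0<a 0<m

  -- P∞ + m√D ≥ 0 and PN ≥ 0 are the third conditions for t Δ∞ and t Δₙ (B = bₙ, C = cₙ, u = U).
  module Comparison (a t u y B C : ℤ) (1≤a : 1ℤ ≤ a) (0≤t : 0ℤ ≤ t) (0≤u : 0ℤ ≤ u) (0≤y : 0ℤ ≤ y)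
                    (0<B : 0ℤ < B) (B≤C : B ≤ C)
                    (markov : B * B + C * C + a * a ≡ + 3 * a * B * C)
                    (large : + 3 * (a * a) * (a * a) * t < B) where

    open Approximation a B C 1≤a 0<B B≤C markov

    private
      P∞-identity : ∀ a t u y → + 2 * a * t - + 3 * a * (u + y) ≡ + 2 * (a * (t - + 3 * y)) - + 3 * a * (u - y)
      P∞-identity = solve-∀

      PN-identity : ∀ a t u y B C →
        t * a * B * C - u * B * B - y * C * C
          ≡ a * a * y + B * (a * (t - + 3 * y) * C - (u - y) * B) - y * (B * B + C * C + a * a - + 3 * a * B * C)
      PN-identity = solve-∀

      negative-PN-identity : ∀ a y B M → - (a * a * y + B * M) ≡ (B - a * a * y) + B * (- M - 1ℤ)
      negative-PN-identity = solve-∀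

      P-bound-identity : ∀ a t w →
        + 3 * a * (+ 3 * (a * a) * t - w) ≡ (+ 2 * a * t - + 3 * a * w) + a * t * (+ 9 * a * a - + 2)
      P-bound-identity = solve-∀

      norm-bound-identity : ∀ a t u y →
        let w = u + y; P = + 2 * a * t - + 3 * a * (u + y); D = + 9 * a * a - + 4 in
        + 4 * (w * (+ 3 * (a * a) * t - w) - a * a * t * t)
          ≡ (D * (u - y) * (u - y) - P * P) + D * ((+ 2 * y) * (+ 2 * u))
      norm-bound-identity = solve-∀

      PN-bound-identity : ∀ a t u y B C →
        B * B * (+ 3 * (a * a) * t - (u + y))
          ≡ (t * a * B * C - u * B * B - y * C * C) + a * t * B * (+ 3 * a * B - C) + y * ((C - B) * (C + B))
      PN-bound-identity = solve-∀

      C-bound-identity : ∀ a B C →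
        C * (+ 3 * a * B - C) ≡ (B * B + a * a) - 1ℤ * (B * B + C * C + a * a - + 3 * a * B * C)
      C-bound-identity = solve-∀

      nine-identity : ∀ a k → + 9 * a * a - k ≡ + 9 * (a - 1ℤ) * a + + 9 * (a - 1ℤ) + (+ 9 - k)
      nine-identity = solve-∀

      w-identity : ∀ u y → u + y ≡ (u - y) + + 2 * y
      w-identity = solve-∀

      a⁴t-identity : ∀ a t → a * a * (+ 3 * (a * a) * t) ≡ + 3 * (a * a) * (a * a) * t
      a⁴t-identity = solve-∀

      m-identity : ∀ a u y → a * a * (u + y) - a * a * (u - y) ≡ a * a * (+ 2 * y)
      m-identity = solve-∀

      -m-identity : ∀ a u y → a * a * (u + y) - a * a * (- (u - y)) ≡ a * a * (+ 2 * u)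
      -m-identity = solve-∀

      y-identity : ∀ a u y → a * a * (u + y) - a * a * y ≡ a * a * u
      y-identity = solve-∀

    P∞ m PN X : ℤ
    P∞ = + 2 * a * t - + 3 * a * (u + y)
    m  = u - y
    PN = t * a * B * C - u * B * B - y * C * C
    X  = a * (t - + 3 * y)

    private
      0≤a = ℤP.<⇒≤ 0<a
      0≤a*a = *-nonNeg 0≤a 0≤a

      0≤9a²- : ∀ k → 0ℤ ≤ + 9 - k → 0ℤ ≤ + 9 * a * a - k
      0≤9a²- k 0≤9-k = nonNeg-by (nine-identity a k)
        (+-nonNeg (+-nonNeg (*-nonNeg (*-nonNeg (0≤+ 9) (ℤP.i≤j⇒0≤j-i 1≤a)) 0≤a)
                            (*-nonNeg (0≤+ 9) (ℤP.i≤j⇒0≤j-i 1≤a)))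
                  0≤9-k)

    bound-from-P : 0ℤ ≤ P∞ → u + y ≤ + 3 * (a * a) * t
    bound-from-P 0≤P = ℤP.0≤i-j⇒j≤i (*-cancelˡ-nonNeg (*-pos (0<+ 2) 0<a)
      (nonNeg-by (P-bound-identity a t (u + y))
        (+-nonNeg 0≤P (*-nonNeg (*-nonNeg 0≤a 0≤t) (0≤9a²- (+ 2) (0≤+ 7))))))

    bound-from-nonNeg√ : NonNegℤ√ D P∞ m → u + y ≤ + 3 * (a * a) * t
    bound-from-nonNeg√ (inj₁ (0≤P , _))               = bound-from-P 0≤P
    bound-from-nonNeg√ (inj₂ (inj₁ (0≤P , _)))        = bound-from-P 0≤P
    bound-from-nonNeg√ (inj₂ (inj₂ (_ , 0<m , PP≤Dmm))) =
      ℤP.0≤i-j⇒j≤i (*-cancelˡ-nonNeg 0<w 0≤w[3a²t-w])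
      where
      0<w : 0ℤ < u + y
      0<w = pos-by (w-identity u y) (+-pos 0<m (*-nonNeg (0≤+ 2) 0≤y))
      0≤excess : 0ℤ ≤ (u + y) * (+ 3 * (a * a) * t - (u + y)) - a * a * t * t
      0≤excess = *-cancelˡ-nonNeg (0<+ 3) (nonNeg-by (norm-bound-identity a t u y)
        (+-nonNeg (ℤP.i≤j⇒0≤j-i PP≤Dmm)
                  (*-nonNeg (0≤9a²- (+ 4) (0≤+ 5)) (*-nonNeg (*-nonNeg (0≤+ 2) 0≤y) (*-nonNeg (0≤+ 2) 0≤u)))))
      0≤w[3a²t-w] : 0ℤ ≤ (u + y) * (+ 3 * (a * a) * t - (u + y))
      0≤w[3a²t-w] = nonNeg-by (i≡[i-j]+j _ (a * a * t * t)) (+-nonNeg 0≤excess (*-nonNeg (*-nonNeg 0≤a*a 0≤t) 0≤t))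

    bound-from-PN : 0ℤ ≤ PN → u + y ≤ + 3 * (a * a) * t
    bound-from-PN 0≤PN = ℤP.0≤i-j⇒j≤i (*-cancelˡ-nonNeg (*-pos 0<B 0<B)
      (nonNeg-by (PN-bound-identity a t u y B C)
        (+-nonNeg (+-nonNeg 0≤PN (*-nonNeg (*-nonNeg (*-nonNeg 0≤a 0≤t) (ℤP.<⇒≤ 0<B)) (ℤP.<⇒≤ 0<3aB-C)))
                  (*-nonNeg 0≤y (*-nonNeg (ℤP.i≤j⇒0≤j-i B≤C) (ℤP.<⇒≤ (+-pos 0<C (ℤP.<⇒≤ 0<B))))))))
      where
      0<3aB-C : 0ℤ < + 3 * a * B - C
      0<3aB-C = *-cancelˡ-pos 0≤C (pos-by (trans (C-bound-identity a B C) (drop-markov (B * B + a * a) 1ℤ))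
        (+-pos (*-pos 0<B 0<B) 0≤a*a))

    module Bounded (w≤3a²t : u + y ≤ + 3 * (a * a) * t) where

      a²w<B : a * a * (u + y) < B
      a²w<B = ℤP.≤-<-trans (ℤP.≤-trans (ℤP.*-monoˡ-≤-nonNeg (a * a) {{ℤ.nonNegative 0≤a*a}} w≤3a²t)
                                        (ℤP.≤-reflexive (a⁴t-identity a t)))
                           large

      below-B : ∀ v → 0ℤ ≤ a * a * (u + y) - v → v < B
      below-B v 0≤a²w-v = ℤP.≤-<-trans (ℤP.0≤i-j⇒j≤i 0≤a²w-v) a²w<B

      a²m<C : a * a * m < C
      a²m<C = ℤP.<-≤-trans (below-B _ (nonNeg-by (m-identity a u y) (*-nonNeg 0≤a*a (*-nonNeg (0≤+ 2) 0≤y)))) B≤C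

      a²[-m]<C : a * a * (- m) < C
      a²[-m]<C = ℤP.<-≤-trans (below-B _ (nonNeg-by (-m-identity a u y) (*-nonNeg 0≤a*a (*-nonNeg (0≤+ 2) 0≤u)))) B≤C

      a²y<B : a * a * y < B
      a²y<B = below-B _ (nonNeg-by (y-identity a u y) (*-nonNeg 0≤a*a 0≤u))

    PN≡ : PN ≡ a * a * y + B * M X m
    PN≡ = trans (PN-identity a t u y B C) (drop-markov (a * a * y + B * M X m) y)

    nonNeg√⇔nonNeg : NonNegℤ√ D P∞ m ⇔ 0ℤ ≤ PN
    nonNeg√⇔nonNeg = mk⇔ to from
      where
      to : NonNegℤ√ D P∞ m → 0ℤ ≤ PN
      to nonNeg√ = nonNeg-by PN≡ (+-nonNeg (*-nonNeg 0≤a*a 0≤y) (*-nonNeg (ℤP.<⇒≤ 0<B)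
        (nonNeg√⇒nonNeg X m a²m<C (subst (λ p → NonNegℤ√ D p m) (P∞-identity a t u y) nonNeg√))))
        where open Bounded (bound-from-nonNeg√ nonNeg√)
      from : 0ℤ ≤ PN → NonNegℤ√ D P∞ m
      from 0≤PN with 0ℤ ℤP.≤? M X m
      ... | yes 0≤M = subst (λ p → NonNegℤ√ D p m) (sym (P∞-identity a t u y)) (nonNeg⇒nonNeg√ X m a²[-m]<C 0≤M)
        where open Bounded (bound-from-PN 0≤PN)
      ... | no M≱0 = contradiction 0<-[a²y+BM] (nonNeg-neg-pos⊥ (nonNeg-by (sym PN≡) 0≤PN))
        where
        open Bounded (bound-from-PN 0≤PN)
        0<-[a²y+BM] : 0ℤ < - (a * a * y + B * M X m)
        0<-[a²y+BM] = pos-by (negative-PN-identity a y B (M X m))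
          (+-pos (<⇒0<j-i a²y<B) (*-nonNeg (ℤP.<⇒≤ 0<B) (<0⇒0≤-i-1 (ℤP.≰⇒> M≱0))))

  module Conjugates (a : ℤ) (1≤a : 1ℤ ≤ a) where

    private
      D = + 9 * a * a - + 4

      0<3a : 0ℤ < + 3 * a
      0<3a = *-pos (0<+ 2) (ℤP.<-≤-trans (0<+ 0) 1≤a)

      conjugate-identity : ∀ a u →
        (+ 9 * a * a - + 4) * (- u) * (- u) - (+ 3 * a * u) * (+ 3 * a * u) ≡ - (+ 4 * ((- u) * (- u)))
      conjugate-identity = solve-∀

      conjugate-identity′ : ∀ a u →
        (+ 3 * a * u) * (+ 3 * a * u) - (+ 9 * a * a - + 4) * (- u) * (- u) ≡ + 4 * (u * u)
      conjugate-identity′ = solve-∀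

    nonNeg√[3a+√D] : ∀ y → NonNegℤ√ D (+ 3 * a * y) y ⇔ 0ℤ ≤ y
    nonNeg√[3a+√D] y = mk⇔ to (λ 0≤y → inj₁ (*-nonNeg (ℤP.<⇒≤ 0<3a) 0≤y , 0≤y))
      where
      to : NonNegℤ√ D (+ 3 * a * y) y → 0ℤ ≤ y
      to (inj₁ (_ , 0≤y))               = 0≤y
      to (inj₂ (inj₁ (0≤3ay , _ , _)))  = *-cancelˡ-nonNeg 0<3a 0≤3ay
      to (inj₂ (inj₂ (_ , 0<y , _)))    = ℤP.<⇒≤ 0<y

    nonNeg√[3a-√D] : ∀ u → NonNegℤ√ D (+ 3 * a * u) (- u) ⇔ 0ℤ ≤ u
    nonNeg√[3a-√D] u = mk⇔ to from
      where
      to : NonNegℤ√ D (+ 3 * a * u) (- u) → 0ℤ ≤ u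
      to (inj₁ (0≤3au , _))                  = *-cancelˡ-nonNeg 0<3a 0≤3au
      to (inj₂ (inj₁ (0≤3au , _ , _)))       = *-cancelˡ-nonNeg 0<3a 0≤3au
      to (inj₂ (inj₂ (_ , 0<-u , PP≤Duu))) = contradiction
        (nonNeg-by (sym (conjugate-identity a u)) (ℤP.i≤j⇒0≤j-i PP≤Duu))
        (pos-nonNeg-neg⊥ (*-pos (0<+ 3) (*-pos 0<-u 0<-u)))
      from : 0ℤ ≤ u → NonNegℤ√ D (+ 3 * a * u) (- u)
      from 0≤u with ℤP.<-cmp 0ℤ u
      ... | tri≈ _ refl _ = inj₁ (*-nonNeg (ℤP.<⇒≤ 0<3a) ℤP.≤-refl , ℤP.≤-refl)
      ... | tri> _ _ u<0  = contradiction 0≤u (ℤP.<⇒≱ u<0)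
      ... | tri< 0<u _ _  = inj₂ (inj₁ (*-nonNeg (ℤP.<⇒≤ 0<3a) 0≤u , ℤP.neg-mono-< 0<u ,
          ℤP.0≤i-j⇒j≤i (nonNeg-by (conjugate-identity′ a u) (*-nonNeg (0≤+ 4) (*-nonNeg 0≤u 0≤u)))))

module MarkovSequence (a b c : ℕ) (b≤a : b ℕ.≤ a) (markov : IsMarkovTriple b a c) where

  open import Data.Integer using (+_; 0ℤ; 1ℤ; _+_; _*_; _-_; _≤_; _<_)
  import Data.Integer.Properties as ℤP
  open import Data.Integer.Tactic.RingSolver using (solve-∀)
  open Positivity

  private
    vieta-identity : ∀ a b c →
      c * c + (+ 3 * a * c - b) * (+ 3 * a * c - b) + a * a
        ≡ + 3 * a * c * (+ 3 * a * c - b) + ((b * b + c * c + a * a) - + 3 * a * b * c)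
    vieta-identity = solve-∀

    reorder-sum : ∀ a b c → b * b + c * c + a * a ≡ b * b + a * a + c * c
    reorder-sum = solve-∀

    reorder-product : ∀ a b c → + 3 * b * a * c ≡ + 3 * a * b * c
    reorder-product = solve-∀

    initial-identity : ∀ a b c → a * c - b ≡ a * (c - 1ℤ) + (a - b)
    initial-identity = solve-∀

    next-identity : ∀ a b c → a * (+ 3 * a * c - b) - c ≡ a * (a * c - b) + (+ 2 * ((a - 1ℤ) * (a + 1ℤ)) + 1ℤ) * c
    next-identity = solve-∀

    growth-identity : ∀ a b c n →
      (+ 3 * a * c - b) - (1ℤ + n) ≡ ((c - (1ℤ + n)) + ((a * c - b) + + 2 * (a - 1ℤ) * c)) + c
    growth-identity = solve-∀

    monotone-identity : ∀ a b c → (+ 3 * a * c - b) - c ≡ (a * c - b) + (+ 2 * (a - 1ℤ) + 1ℤ) * c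
    monotone-identity = solve-∀

    0<b = let (0<b , _ , _ , _) = markov in 0<b
    0<a = let (_ , 0<a , _ , _) = markov in 0<a
    0<c = let (_ , _ , 0<c , _) = markov in 0<c
    0≤a-1 = ℤP.i≤j⇒0≤j-i (ℤ.+≤+ 0<a)
    0≤a = ℤP.≤-trans (0≤+ 1) (ℤ.+≤+ 0<a)

  B C : ℕ → ℤ
  B = bSeq (+ a) (+ b) (+ c)
  C = cSeq (+ a) (+ b) (+ c)

  markov-invariant : ∀ n → B n * B n + C n * C n + + a * + a ≡ + 3 * + a * B n * C n
  markov-invariant zero = begin
    + b * + b + + c * + c + + a * + a   ≡⟨ reorder-sum (+ a) (+ b) (+ c) ⟩
    + b * + b + + a * + a + + c * + c   ≡⟨ cast-sum ⟨
    + (b ℕ.* b ℕ.+ a ℕ.* a ℕ.+ c ℕ.* c) ≡⟨ cong +_ (let (_ , _ , _ , eq) = markov in eq) ⟩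
    + (3 ℕ.* b ℕ.* a ℕ.* c)             ≡⟨ cast-product ⟩
    + 3 * + b * + a * + c               ≡⟨ reorder-product (+ a) (+ b) (+ c) ⟩
    + 3 * + a * + b * + c               ∎
    where
    open ≡-Reasoning
    cast-sum : + (b ℕ.* b ℕ.+ a ℕ.* a ℕ.+ c ℕ.* c) ≡ + b * + b + + a * + a + + c * + c
    cast-sum = trans (ℤP.pos-+ (b ℕ.* b ℕ.+ a ℕ.* a) (c ℕ.* c))
      (cong₂ _+_ (trans (ℤP.pos-+ (b ℕ.* b) (a ℕ.* a)) (cong₂ _+_ (ℤP.pos-* b b) (ℤP.pos-* a a))) (ℤP.pos-* c c))
    cast-product : + (3 ℕ.* b ℕ.* a ℕ.* c) ≡ + 3 * + b * + a * + c
    cast-product = trans (ℤP.pos-* (3 ℕ.* b ℕ.* a) c)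
      (cong (_* + c) (trans (ℤP.pos-* (3 ℕ.* b) a) (cong (_* + a) (ℤP.pos-* 3 b))))
  markov-invariant (suc n) = trans (vieta-identity (+ a) (B n) (C n))
    (trans (cong (λ z → + 3 * + a * C n * C (suc n) + z) (ℤP.i≡j⇒i-j≡0 (markov-invariant n)))
           (ℤP.+-identityʳ _))

  growth : ∀ n → 1ℤ ≤ B n × 0ℤ ≤ + a * C n - B n × + n < C n
  growth zero =
    ℤ.+≤+ 0<b ,
    nonNeg-by (initial-identity (+ a) (+ b) (+ c))
      (+-nonNeg (*-nonNeg 0≤a (ℤP.i≤j⇒0≤j-i (ℤ.+≤+ 0<c))) (ℤP.i≤j⇒0≤j-i (ℤ.+≤+ b≤a))) ,
    ℤ.+<+ 0<c
  growth (suc n) =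
    let (_ , 0≤aC-B , n<C) = growth n
        0<C = ℤP.≤-<-trans (0≤+ n) n<C
        0≤C = ℤP.<⇒≤ 0<C
    in ℤP.i<j⇒suc[i]≤j 0<C ,
       nonNeg-by (next-identity (+ a) (B n) (C n))
         (+-nonNeg (*-nonNeg 0≤a 0≤aC-B)
                   (*-nonNeg (+-nonNeg (*-nonNeg (0≤+ 2) (*-nonNeg 0≤a-1 (+-nonNeg 0≤a (0≤+ 1)))) (0≤+ 1)) 0≤C)) ,
       0<j-i⇒< (+ suc n) (pos-by (growth-identity (+ a) (B n) (C n) (+ n))
         (ℤP.+-mono-≤-< (+-nonNeg (ℤP.i≤j⇒0≤j-i (ℤP.i<j⇒suc[i]≤j n<C))
                                  (+-nonNeg 0≤aC-B (*-nonNeg (*-nonNeg (0≤+ 2) 0≤a-1) 0≤C)))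
                        0<C))

  0<B : ∀ n → 0ℤ < B n
  0<B n = let (1≤B , _ , _) = growth n in ℤP.<-≤-trans (0<+ 0) 1≤B

  0<C : ∀ n → 0ℤ < C n
  0<C n = let (_ , _ , n<C) = growth n in ℤP.≤-<-trans (0≤+ n) n<C

  B≤C : ∀ n → B (suc n) ≤ C (suc n)
  B≤C n = let (_ , 0≤aC-B , _) = growth n in
    ℤP.0≤i-j⇒j≤i (nonNeg-by (monotone-identity (+ a) (B n) (C n))
      (+-nonNeg 0≤aC-B (*-nonNeg (+-nonNeg (*-nonNeg (0≤+ 2) 0≤a-1) (0≤+ 1)) (ℤP.<⇒≤ (0<C n)))))

  n<B : ∀ n → + n < B (suc n)
  n<B n = let (_ , _ , n<C) = growth n in n<C

module RationalEmbedding where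

  open import Data.Integer using (+_; +[1+_]; -[1+_])
  import Data.Integer.Properties as ℤP
  open import Data.Rational using (mkℚ; 0ℚ; 1ℚ; _+_; _*_; _-_; -_; _≤_; _<_; toℚᵘ)
  open import Data.Rational.Properties as ℚP
    using (toℚᵘ-injective; toℚᵘ-fromℚᵘ; toℚᵘ-homo-+; toℚᵘ-homo-*; toℚᵘ-homo‿-;
           toℚᵘ-mono-≤; toℚᵘ-cancel-≤; toℚᵘ-mono-<; toℚᵘ-cancel-<)
  open import Data.Rational.Unnormalised as ℚᵘ using (mkℚᵘ; *≡*; *≤*; *<*)
  import Data.Rational.Unnormalised.Properties as ℚᵘP
  open import Data.Maybe using (Maybe; just; nothing)
  open import Data.Empty using (⊥-elim)
  open import Relation.Nullary using (yes; no)
  import Tactic.RingSolver.Core.AlmostCommutativeRing as ACR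

  ℚ-ring : ACR.AlmostCommutativeRing _ _
  ℚ-ring = ACR.fromCommutativeRing ℚP.+-*-commutativeRing isZero
    where
    isZero : ∀ x → Maybe (0ℚ ≡ x)
    isZero x with 0ℚ ℚP.≟ x
    ... | yes 0≡x = just 0≡x
    ... | no _    = nothing

  private
    toℚᵘ-fromℤ : ∀ i → toℚᵘ (fromℤ i) ℚᵘ.≃ mkℚᵘ i 0
    toℚᵘ-fromℤ i = toℚᵘ-fromℚᵘ (mkℚᵘ i 0)

  fromℤ-+ : ∀ i j → fromℤ (i ℤ.+ j) ≡ fromℤ i + fromℤ j
  fromℤ-+ i j = toℚᵘ-injective (ℚᵘP.≃-trans (toℚᵘ-fromℤ (i ℤ.+ j))
    (ℚᵘP.≃-sym (ℚᵘP.≃-trans (toℚᵘ-homo-+ (fromℤ i) (fromℤ j))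
      (ℚᵘP.≃-trans (ℚᵘP.+-cong (toℚᵘ-fromℤ i) (toℚᵘ-fromℤ j))
        (*≡* (cong (ℤ._* + 1) (cong₂ ℤ._+_ (ℤP.*-identityʳ i) (ℤP.*-identityʳ j))))))))

  fromℤ-* : ∀ i j → fromℤ (i ℤ.* j) ≡ fromℤ i * fromℤ j
  fromℤ-* i j = toℚᵘ-injective (ℚᵘP.≃-trans (toℚᵘ-fromℤ (i ℤ.* j))
    (ℚᵘP.≃-sym (ℚᵘP.≃-trans (toℚᵘ-homo-* (fromℤ i) (fromℤ j))
      (ℚᵘP.*-cong (toℚᵘ-fromℤ i) (toℚᵘ-fromℤ j)))))

  fromℤ-neg : ∀ i → fromℤ (ℤ.- i) ≡ - fromℤ i
  fromℤ-neg i = toℚᵘ-injective (ℚᵘP.≃-trans (toℚᵘ-fromℤ (ℤ.- i))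
    (ℚᵘP.≃-sym (ℚᵘP.≃-trans (toℚᵘ-homo‿- (fromℤ i)) (ℚᵘP.-‿cong (toℚᵘ-fromℤ i)))))

  fromℤ-- : ∀ i j → fromℤ (i ℤ.- j) ≡ fromℤ i - fromℤ j
  fromℤ-- i j = trans (fromℤ-+ i (ℤ.- j)) (cong (λ r → fromℤ i + r) (fromℤ-neg j))

  fromℤ-mono-≤ : ∀ {i j} → i ℤ.≤ j → fromℤ i ≤ fromℤ j
  fromℤ-mono-≤ {i} {j} i≤j = toℚᵘ-cancel-≤
    (ℚᵘP.≤-respˡ-≃ (ℚᵘP.≃-sym (toℚᵘ-fromℤ i)) (ℚᵘP.≤-respʳ-≃ (ℚᵘP.≃-sym (toℚᵘ-fromℤ j))
      (*≤* (subst₂ ℤ._≤_ (sym (ℤP.*-identityʳ i)) (sym (ℤP.*-identityʳ j)) i≤j))))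

  fromℤ-cancel-≤ : ∀ {i j} → fromℤ i ≤ fromℤ j → i ℤ.≤ j
  fromℤ-cancel-≤ {i} {j} i≤j
    with ℚᵘP.≤-respˡ-≃ (toℚᵘ-fromℤ i) (ℚᵘP.≤-respʳ-≃ (toℚᵘ-fromℤ j) (toℚᵘ-mono-≤ i≤j))
  ... | *≤* i*1≤j*1 = subst₂ ℤ._≤_ (ℤP.*-identityʳ i) (ℤP.*-identityʳ j) i*1≤j*1

  fromℤ-mono-< : ∀ {i j} → i ℤ.< j → fromℤ i < fromℤ j
  fromℤ-mono-< {i} {j} i<j = toℚᵘ-cancel-<
    (ℚᵘP.<-respˡ-≃ (ℚᵘP.≃-sym (toℚᵘ-fromℤ i)) (ℚᵘP.<-respʳ-≃ (ℚᵘP.≃-sym (toℚᵘ-fromℤ j))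
      (*<* (subst₂ ℤ._<_ (sym (ℤP.*-identityʳ i)) (sym (ℤP.*-identityʳ j)) i<j))))

  fromℤ-cancel-< : ∀ {i j} → fromℤ i < fromℤ j → i ℤ.< j
  fromℤ-cancel-< {i} {j} i<j
    with ℚᵘP.<-respˡ-≃ (toℚᵘ-fromℤ i) (ℚᵘP.<-respʳ-≃ (toℚᵘ-fromℤ j) (toℚᵘ-mono-< i<j))
  ... | *<* i*1<j*1 = subst₂ ℤ._<_ (ℤP.*-identityʳ i) (ℤP.*-identityʳ j) i*1<j*1

  invℚ-inverseʳ : ∀ {p} → p ≢ 0ℚ → p * invℚ p ≡ 1ℚ
  invℚ-inverseʳ {p@(mkℚ +[1+ _ ] _ _)} _   = ℚP.*-inverseʳ p
  invℚ-inverseʳ {p@(mkℚ -[1+ _ ] _ _)} _   = ℚP.*-inverseʳ p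
  invℚ-inverseʳ {p@(mkℚ (+ zero) _ _)} p≢0 = ⊥-elim (p≢0 (ℚP.↥p≡0⇒p≡0 p refl))

  >⇒≢0 : ∀ {p} → 0ℚ < p → p ≢ 0ℚ
  >⇒≢0 0<p p≡0 = ℚP.<-irrefl (sym p≡0) 0<p

  invℚ-pos : ∀ {p} → 0ℚ < p → 0ℚ < invℚ p
  invℚ-pos {p@(mkℚ +[1+ n ] _ _)} _ = ℚP.positive⁻¹ (ℚ.1/ p)
  invℚ-pos {mkℚ (+ zero) _ _} (ℚ.*<* (ℤ.+<+ ()))
  invℚ-pos {mkℚ -[1+ n ] _ _} (ℚ.*<* ())

  *-pos : ∀ {p q} → 0ℚ < p → 0ℚ < q → 0ℚ < p * q
  *-pos {p} {q} 0<p 0<q =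
    ℚP.positive⁻¹ (p * q) {{ℚP.pos*pos⇒pos p {{ℚ.positive 0<p}} q {{ℚ.positive 0<q}}}}

module QuadraticField (D : ℚ) where

  open import Data.Rational using (0ℚ; 1ℚ; _+_; _*_; _-_; -_; _≤_; _<_)
  import Data.Rational.Properties as ℚP
  open import Data.Maybe using (Maybe; just; nothing)
  open import Data.Empty using (⊥-elim)
  open import Algebra.Bundles using (CommutativeRing)
  import Algebra.Solver.Ring
  import Algebra.Solver.Ring.AlmostCommutativeRing as ACR
  open import Relation.Nullary using (yes; no)
  open import Tactic.RingSolver using (solve-∀)
  open RationalEmbedding
  open QuadraticIntegers using (NonNegℤ√)

  open QField D public

  0F 1F : QF
  0F = emb 0ℚ
  1F = emb 1ℚ

  _⊖_ : QF → QF → QF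
  x ⊖ y = x ⊕ (⊝ y)

  private
    mul-comm₁ : ∀ D u v u′ v′ → u * u′ + D * v * v′ ≡ u′ * u + D * v′ * v
    mul-comm₁ = solve-∀ ℚ-ring
    mul-comm₂ : ∀ u v u′ v′ → u * v′ + v * u′ ≡ u′ * v + v′ * u
    mul-comm₂ = solve-∀ ℚ-ring
    mul-assoc₁ : ∀ D u v u′ v′ u″ v″ →
      (u * u′ + D * v * v′) * u″ + D * (u * v′ + v * u′) * v″
        ≡ u * (u′ * u″ + D * v′ * v″) + D * v * (u′ * v″ + v′ * u″)
    mul-assoc₁ = solve-∀ ℚ-ring
    mul-assoc₂ : ∀ D u v u′ v′ u″ v″ →
      (u * u′ + D * v * v′) * v″ + (u * v′ + v * u′) * u″
        ≡ u * (u′ * v″ + v′ * u″) + v * (u′ * u″ + D * v′ * v″)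
    mul-assoc₂ = solve-∀ ℚ-ring
    mul-identity₁ : ∀ D u v → 1ℚ * u + D * 0ℚ * v ≡ u
    mul-identity₁ = solve-∀ ℚ-ring
    mul-identity₂ : ∀ u v → 1ℚ * v + 0ℚ * u ≡ v
    mul-identity₂ = solve-∀ ℚ-ring
    distrib₁ : ∀ D u v u′ v′ u″ v″ →
      u * (u′ + u″) + D * v * (v′ + v″) ≡ (u * u′ + D * v * v′) + (u * u″ + D * v * v″)
    distrib₁ = solve-∀ ℚ-ring
    distrib₂ : ∀ u v u′ v′ u″ v″ →
      u * (v′ + v″) + v * (u′ + u″) ≡ (u * v′ + v * u′) + (u * v″ + v * u″)
    distrib₂ = solve-∀ ℚ-ring
    add-inverse : ∀ u → - u + u ≡ 0ℚ
    add-inverse = solve-∀ ℚ-ring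
    add-identity : ∀ u → 0ℚ + u ≡ u
    add-identity = solve-∀ ℚ-ring
    scale₁ : ∀ D r u v → r * u + D * 0ℚ * v ≡ r * u
    scale₁ = solve-∀ ℚ-ring
    scale₂ : ∀ r u v → r * v + 0ℚ * u ≡ r * v
    scale₂ = solve-∀ ℚ-ring
    norm-mul : ∀ D u v u′ v′ →
      (u * u′ + D * v * v′) * (u * u′ + D * v * v′) - D * (u * v′ + v * u′) * (u * v′ + v * u′)
        ≡ (u * u - D * v * v) * (u′ * u′ - D * v′ * v′)
    norm-mul = solve-∀ ℚ-ring
    inverse₁ : ∀ D u v n → u * (u * n) + D * v * (- v * n) ≡ (u * u - D * v * v) * n
    inverse₁ = solve-∀ ℚ-ring
    inverse₂ : ∀ u v n → u * (- v * n) + v * (u * n) ≡ 0ℚ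
    inverse₂ = solve-∀ ℚ-ring
    norm-one : ∀ D → 1ℚ * 1ℚ - D * 0ℚ * 0ℚ ≡ 1ℚ
    norm-one = solve-∀ ℚ-ring
    scaled-square : ∀ D s v → D * (s * v) * (s * v) ≡ (s * s) * (D * v * v)
    scaled-square = solve-∀ ℚ-ring
    square-scaled : ∀ s u → (s * u) * (s * u) ≡ (s * s) * (u * u)
    square-scaled = solve-∀ ℚ-ring

  ⊗-comm : ∀ x y → x ⊗ y ≡ y ⊗ x
  ⊗-comm (u , v) (u′ , v′) = cong₂ _,_ (mul-comm₁ D u v u′ v′) (mul-comm₂ u v u′ v′)

  ⊗-assoc : ∀ x y z → (x ⊗ y) ⊗ z ≡ x ⊗ (y ⊗ z)
  ⊗-assoc (u , v) (u′ , v′) (u″ , v″) =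
    cong₂ _,_ (mul-assoc₁ D u v u′ v′ u″ v″) (mul-assoc₂ D u v u′ v′ u″ v″)

  ⊗-identityˡ : ∀ x → 1F ⊗ x ≡ x
  ⊗-identityˡ (u , v) = cong₂ _,_ (mul-identity₁ D u v) (mul-identity₂ u v)

  ⊗-identityʳ : ∀ x → x ⊗ 1F ≡ x
  ⊗-identityʳ x = trans (⊗-comm x 1F) (⊗-identityˡ x)

  ⊗-distribˡ-⊕ : ∀ x y z → x ⊗ (y ⊕ z) ≡ (x ⊗ y) ⊕ (x ⊗ z)
  ⊗-distribˡ-⊕ (u , v) (u′ , v′) (u″ , v″) =
    cong₂ _,_ (distrib₁ D u v u′ v′ u″ v″) (distrib₂ u v u′ v′ u″ v″)

  ⊕-comm : ∀ x y → x ⊕ y ≡ y ⊕ x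
  ⊕-comm (u , v) (u′ , v′) = cong₂ _,_ (ℚP.+-comm u u′) (ℚP.+-comm v v′)

  ⊕-assoc : ∀ x y z → (x ⊕ y) ⊕ z ≡ x ⊕ (y ⊕ z)
  ⊕-assoc (u , v) (u′ , v′) (u″ , v″) = cong₂ _,_ (ℚP.+-assoc u u′ u″) (ℚP.+-assoc v v′ v″)

  ⊕-identityˡ : ∀ x → 0F ⊕ x ≡ x
  ⊕-identityˡ (u , v) = cong₂ _,_ (add-identity u) (add-identity v)

  ⊝-inverseˡ : ∀ x → (⊝ x) ⊕ x ≡ 0F
  ⊝-inverseˡ (u , v) = cong₂ _,_ (add-inverse u) (add-inverse v)

  commutativeRing : CommutativeRing _ _
  commutativeRing = record
    { Carrier = QF ; _≈_ = _≡_ ; _+_ = _⊕_ ; _*_ = _⊗_ ; -_ = ⊝_ ; 0# = 0F ; 1# = 1F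
    ; isCommutativeRing = record
      { isRing = record
        { +-isAbelianGroup = record
          { isGroup = record
            { isMonoid = record
              { isSemigroup = record
                { isMagma = record { isEquivalence = isEquivalence ; ∙-cong = cong₂ _⊕_ }
                ; assoc = ⊕-assoc }
              ; identity = ⊕-identityˡ , λ x → trans (⊕-comm x 0F) (⊕-identityˡ x) }
            ; inverse = ⊝-inverseˡ , λ x → trans (⊕-comm x (⊝ x)) (⊝-inverseˡ x)
            ; ⁻¹-cong = cong ⊝_ }
          ; comm = ⊕-comm }
        ; *-cong = cong₂ _⊗_
        ; *-assoc = ⊗-assoc
        ; *-identity = ⊗-identityˡ , ⊗-identityʳ
        ; distrib = ⊗-distribˡ-⊕
                  , λ x y z → trans (⊗-comm (y ⊕ z) x)
                                (trans (⊗-distribˡ-⊕ x y z) (cong₂ _⊕_ (⊗-comm x y) (⊗-comm x z))) }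
      ; *-comm = ⊗-comm } }

  emb-⊗ : ∀ r s → emb r ⊗ emb s ≡ emb (r * s)
  emb-⊗ r s = cong₂ _,_ (scale₁ D r s 0ℚ) (trans (scale₂ r s 0ℚ) (ℚP.*-zeroʳ r))

  emb-⊗-pair : ∀ r u v → emb r ⊗ (u , v) ≡ (r * u , r * v)
  emb-⊗-pair r u v = cong₂ _,_ (scale₁ D r u v) (scale₂ r u v)

  pair-⊗-emb : ∀ r u v → (u , v) ⊗ emb r ≡ (r * u , r * v)
  pair-⊗-emb r u v = trans (⊗-comm (u , v) (emb r)) (emb-⊗-pair r u v)

  ι : ℤ → QF
  ι z = emb (fromℤ z)

  private
    ι-homomorphism : ℤ.+-*-rawRing ACR.-Raw-AlmostCommutative⟶ ACR.fromCommutativeRing commutativeRing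
    ι-homomorphism = record
      { ⟦_⟧    = ι
      ; +-homo = λ i j → cong emb (fromℤ-+ i j)
      ; *-homo = λ i j → trans (cong emb (fromℤ-* i j)) (sym (emb-⊗ (fromℤ i) (fromℤ j)))
      ; -‿homo = λ i → cong emb (fromℤ-neg i)
      ; 0-homo = refl
      ; 1-homo = refl }

    ι-equal? : ∀ i j → Maybe (ι i ≡ ι j)
    ι-equal? i j with i ℤ.≟ j
    ... | yes i≡j = just (cong ι i≡j)
    ... | no _    = nothing

  module QF-Solver =
    Algebra.Solver.Ring ℤ.+-*-rawRing (ACR.fromCommutativeRing commutativeRing) ι-homomorphism ι-equal?

  norm : QF → ℚ
  norm (u , v) = u * u - D * v * v

  norm-⊗ : ∀ x y → norm (x ⊗ y) ≡ norm x * norm y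
  norm-⊗ (u , v) (u′ , v′) = norm-mul D u v u′ v′

  ⊗-inverseʳ : ∀ x → norm x ≢ 0ℚ → x ⊗ inv x ≡ 1F
  ⊗-inverseʳ (u , v) norm≢0 = cong₂ _,_
    (trans (inverse₁ D u v (invℚ (norm (u , v)))) (invℚ-inverseʳ norm≢0))
    (inverse₂ u v (invℚ (norm (u , v))))

  inv-unique : ∀ x y → x ⊗ y ≡ 1F → inv x ≡ y
  inv-unique x y x⊗y≡1 = begin
    inv x              ≡⟨ ⊗-identityʳ (inv x) ⟨
    inv x ⊗ 1F         ≡⟨ cong (inv x ⊗_) (sym x⊗y≡1) ⟩
    inv x ⊗ (x ⊗ y)    ≡⟨ sym (⊗-assoc (inv x) x y) ⟩
    (inv x ⊗ x) ⊗ y    ≡⟨ cong (_⊗ y) (trans (⊗-comm (inv x) x) (⊗-inverseʳ x norm≢0)) ⟩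
    1F ⊗ y             ≡⟨ ⊗-identityˡ y ⟩
    y                  ∎
    where
    open ≡-Reasoning
    norm≢0 : norm x ≢ 0ℚ
    norm≢0 norm≡0 = ℚP.1≢0 (begin
      1ℚ                ≡⟨ sym (norm-one D) ⟩
      norm 1F           ≡⟨ cong norm (sym x⊗y≡1) ⟩
      norm (x ⊗ y)      ≡⟨ norm-⊗ x y ⟩
      norm x * norm y   ≡⟨ cong (_* norm y) norm≡0 ⟩
      0ℚ * norm y       ≡⟨ ℚP.*-zeroˡ (norm y) ⟩
      0ℚ                ∎)

  NonNeg-emb : ∀ r → NonNeg (emb r) ⇔ 0ℚ ≤ r
  NonNeg-emb r = mk⇔ to (λ 0≤r → inj₁ (0≤r , ℚP.≤-refl))
    where
    to : NonNeg (emb r) → 0ℚ ≤ r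
    to (inj₁ (0≤r , _))             = 0≤r
    to (inj₂ (inj₁ (_ , 0<0 , _)))  = ⊥-elim (ℚP.<-irrefl refl 0<0)
    to (inj₂ (inj₂ (_ , 0<0 , _)))  = ⊥-elim (ℚP.<-irrefl refl 0<0)

  NonNeg-scale : ∀ {s} x → 0ℚ < s → NonNeg x → NonNeg (emb s ⊗ x)
  NonNeg-scale {s} (u , v) 0<s nonNeg = subst NonNeg (sym (emb-⊗-pair s u v)) (scaled nonNeg)
    where
    instance
      s-pos : ℚ.Positive s
      s-pos = ℚ.positive 0<s
      s²-nonNeg : ℚ.NonNegative (s * s)
      s²-nonNeg = ℚ.nonNegative (ℚP.<⇒≤ (*-pos 0<s 0<s))
    scale-≤ : ∀ {p q} → p ≤ q → s * p ≤ s * q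
    scale-≤ = ℚP.*-monoˡ-≤-nonNeg s {{ℚP.pos⇒nonNeg s}}
    scale-< : ∀ {p q} → p < q → s * p < s * q
    scale-< = ℚP.*-monoʳ-<-pos s
    scale-0≤ : ∀ {p} → 0ℚ ≤ p → 0ℚ ≤ s * p
    scale-0≤ {p} 0≤p = subst (_≤ s * p) (ℚP.*-zeroʳ s) (scale-≤ 0≤p)
    scale-0< : ∀ {p} → 0ℚ < p → 0ℚ < s * p
    scale-0< {p} 0<p = subst (_< s * p) (ℚP.*-zeroʳ s) (scale-< 0<p)
    scale-<0 : ∀ {p} → p < 0ℚ → s * p < 0ℚ
    scale-<0 {p} p<0 = subst (s * p <_) (ℚP.*-zeroʳ s) (scale-< p<0)
    scale-squares : ∀ {p q} → p ≤ q → (s * s) * p ≤ (s * s) * q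
    scale-squares = ℚP.*-monoˡ-≤-nonNeg (s * s)
    scaled : NonNeg (u , v) → NonNeg (s * u , s * v)
    scaled (inj₁ (0≤u , 0≤v)) = inj₁ (scale-0≤ 0≤u , scale-0≤ 0≤v)
    scaled (inj₂ (inj₁ (0≤u , v<0 , Dvv≤uu))) = inj₂ (inj₁ (scale-0≤ 0≤u , scale-<0 v<0 ,
      subst₂ _≤_ (sym (scaled-square D s v)) (sym (square-scaled s u)) (scale-squares Dvv≤uu)))
    scaled (inj₂ (inj₂ (u<0 , 0<v , uu≤Dvv))) = inj₂ (inj₂ (scale-<0 u<0 , scale-0< 0<v ,
      subst₂ _≤_ (sym (square-scaled s u)) (sym (scaled-square D s v)) (scale-squares uu≤Dvv)))

  NonNeg-scale⇔ : ∀ {s} x → 0ℚ < s → NonNeg (emb s ⊗ x) ⇔ NonNeg x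
  NonNeg-scale⇔ {s} x 0<s = mk⇔ unscale (NonNeg-scale x 0<s)
    where
    unscale : NonNeg (emb s ⊗ x) → NonNeg x
    unscale nonNeg = subst NonNeg s⁻¹⊗s⊗x≡x (NonNeg-scale (emb s ⊗ x) (invℚ-pos 0<s) nonNeg)
      where
      s⁻¹⊗s⊗x≡x : emb (invℚ s) ⊗ (emb s ⊗ x) ≡ x
      s⁻¹⊗s⊗x≡x = begin
        emb (invℚ s) ⊗ (emb s ⊗ x)  ≡⟨ sym (⊗-assoc (emb (invℚ s)) (emb s) x) ⟩
        (emb (invℚ s) ⊗ emb s) ⊗ x  ≡⟨ cong (_⊗ x) (emb-⊗ (invℚ s) s) ⟩
        emb (invℚ s * s) ⊗ x        ≡⟨ cong (λ r → emb r ⊗ x)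
                                          (trans (ℚP.*-comm (invℚ s) s) (invℚ-inverseʳ (>⇒≢0 0<s))) ⟩
        1F ⊗ x                      ≡⟨ ⊗-identityˡ x ⟩
        x                           ∎
        where open ≡-Reasoning

  module _ {Dz : ℤ} (D≡ : D ≡ fromℤ Dz) where

    private
      D-square : ∀ R → D * fromℤ R * fromℤ R ≡ fromℤ (Dz ℤ.* R ℤ.* R)
      D-square R = trans (cong (λ d → d * fromℤ R * fromℤ R) D≡)
                         (sym (trans (fromℤ-* (Dz ℤ.* R) R) (cong (_* fromℤ R) (fromℤ-* Dz R))))
      square : ∀ P → fromℤ P * fromℤ P ≡ fromℤ (P ℤ.* P)
      square P = sym (fromℤ-* P P)

    NonNeg-fromℤ : ∀ P R → NonNeg (fromℤ P , fromℤ R) ⇔ NonNegℤ√ Dz P R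
    NonNeg-fromℤ P R = mk⇔ to from
      where
      to : NonNeg (fromℤ P , fromℤ R) → NonNegℤ√ Dz P R
      to (inj₁ (0≤P , 0≤R)) = inj₁ (fromℤ-cancel-≤ 0≤P , fromℤ-cancel-≤ 0≤R)
      to (inj₂ (inj₁ (0≤P , R<0 , DRR≤PP))) = inj₂ (inj₁ (fromℤ-cancel-≤ 0≤P , fromℤ-cancel-< R<0 ,
        fromℤ-cancel-≤ (subst₂ _≤_ (D-square R) (square P) DRR≤PP)))
      to (inj₂ (inj₂ (P<0 , 0<R , PP≤DRR))) = inj₂ (inj₂ (fromℤ-cancel-< P<0 , fromℤ-cancel-< 0<R ,
        fromℤ-cancel-≤ (subst₂ _≤_ (square P) (D-square R) PP≤DRR)))
      from : NonNegℤ√ Dz P R → NonNeg (fromℤ P , fromℤ R)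
      from (inj₁ (0≤P , 0≤R)) = inj₁ (fromℤ-mono-≤ 0≤P , fromℤ-mono-≤ 0≤R)
      from (inj₂ (inj₁ (0≤P , R<0 , DRR≤PP))) = inj₂ (inj₁ (fromℤ-mono-≤ 0≤P , fromℤ-mono-< R<0 ,
        subst₂ _≤_ (sym (D-square R)) (sym (square P)) (fromℤ-mono-≤ DRR≤PP)))
      from (inj₂ (inj₂ (P<0 , 0<R , PP≤DRR))) = inj₂ (inj₂ (fromℤ-mono-< P<0 , fromℤ-mono-< 0<R ,
        subst₂ _≤_ (sym (square P)) (sym (D-square R)) (fromℤ-mono-≤ PP≤DRR)))

module Barycentric (D : ℚ) where

  open import Data.Integer using (+_)
  open import Data.Rational using (0ℚ; _<_)
  import Data.Rational.Properties as ℚP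
  open RationalEmbedding
  open QuadraticField D
  open QF-Solver using (solve; _:=_; _:+_; _:*_; _:-_; con)

  origin : Pt
  origin = 0F , 0F

  private
    nonNeg-0F : NonNeg 0F
    nonNeg-0F = inj₁ (ℚP.≤-refl , ℚP.≤-refl)

    nonNeg-1F : NonNeg 1F
    nonNeg-1F = inj₁ (fromℤ-mono-≤ {+ 0} {+ 1} (ℤ.+≤+ z≤n) , ℚP.≤-refl)

  InDilate-zero : ∀ {Δ : Pt → Set} v₁ v₂ X → InDilate 0 Δ X → InDilate 0 (InTriangle origin v₁ v₂) X
  InDilate-zero (a₁ , a₂) (b₁ , b₂) X ((Y₁ , Y₂) , _ , X≡0·Y) =
    origin ,
    (1F , 0F , 0F , nonNeg-1F , nonNeg-0F , nonNeg-0F , one ,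
     cong₂ _,_ (origin-combination a₁ b₁) (origin-combination a₂ b₂)) ,
    trans X≡0·Y (cong₂ _,_ (trans (annihilate Y₁) (sym (annihilate 0F)))
                           (trans (annihilate Y₂) (sym (annihilate 0F))))
    where
    one : 1F ⊕ (0F ⊕ 0F) ≡ 1F
    one = solve 0 (con (+ 1) :+ (con (+ 0) :+ con (+ 0)) := con (+ 1)) refl
    origin-combination : ∀ a b → 0F ≡ (1F ⊗ 0F) ⊕ ((0F ⊗ a) ⊕ (0F ⊗ b))
    origin-combination = solve 2
      (λ a b → con (+ 0) := (con (+ 1) :* con (+ 0)) :+ ((con (+ 0) :* a) :+ (con (+ 0) :* b))) refl
    annihilate : ∀ y → 0F ⊗ y ≡ 0F
    annihilate = solve 1 (λ y → con (+ 0) :* y := con (+ 0)) refl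

  module DilatedTriangle (p w h : QF) (p⊗h≡1 : p ⊗ h ≡ 1F) (t : ℕ) (0<t : 0 ℕ.< t) where

    T T⁻¹ : QF
    T   = emb (fromℤ (+ t))
    T⁻¹ = emb (invℚ (fromℤ (+ t)))

    cancel-p⊗h : ∀ z → z ⊗ (p ⊗ h) ≡ z
    cancel-p⊗h z = trans (cong (z ⊗_) p⊗h≡1) (⊗-identityʳ z)

    0<t′ : 0ℚ < fromℤ (+ t)
    0<t′ = fromℤ-mono-< (ℤ.+<+ 0<t)

    T⊗T⁻¹≡1 : T ⊗ T⁻¹ ≡ 1F
    T⊗T⁻¹≡1 = trans (emb-⊗ (fromℤ (+ t)) (invℚ (fromℤ (+ t)))) (cong emb (invℚ-inverseʳ (>⇒≢0 0<t′)))

    Δ : Pt → Set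
    Δ = InTriangle origin (p , 0F) (w , h)

    -- t times the barycentric coordinates of (X₁ , X₂) with respect to (0 , 0), (p , 0), (w , h)
    module _ (X₁ X₂ : QF) where
      γ′ β′ α′ : QF
      γ′ = p ⊗ X₂
      β′ = (h ⊗ X₁) ⊖ (w ⊗ X₂)
      α′ = T ⊖ (β′ ⊕ γ′)

    module _ (α β γ : QF) where

      private
        Y₁ Y₂ : QF
        Y₁ = (α ⊗ 0F) ⊕ ((β ⊗ p) ⊕ (γ ⊗ w))
        Y₂ = (α ⊗ 0F) ⊕ ((β ⊗ 0F) ⊕ (γ ⊗ h))

      γ′-of-dilate : γ′ (T ⊗ Y₁) (T ⊗ Y₂) ≡ T ⊗ γ
      γ′-of-dilate = begin
        p ⊗ (T ⊗ Y₂)          ≡⟨ solve 6 (λ p T α β γ h →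
                                    p :* (T :* ((α :* con (+ 0)) :+ ((β :* con (+ 0)) :+ (γ :* h))))
                                    := (T :* γ) :* (p :* h)) refl p T α β γ h ⟩
        (T ⊗ γ) ⊗ (p ⊗ h)     ≡⟨ cancel-p⊗h (T ⊗ γ) ⟩
        T ⊗ γ                 ∎
        where open ≡-Reasoning

      β′-of-dilate : β′ (T ⊗ Y₁) (T ⊗ Y₂) ≡ T ⊗ β
      β′-of-dilate = begin
        (h ⊗ (T ⊗ Y₁)) ⊖ (w ⊗ (T ⊗ Y₂)) ≡⟨ solve 7 (λ p w h T α β γ →
            (h :* (T :* ((α :* con (+ 0)) :+ ((β :* p) :+ (γ :* w)))))
              :- (w :* (T :* ((α :* con (+ 0)) :+ ((β :* con (+ 0)) :+ (γ :* h)))))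
            := (T :* β) :* (p :* h)) refl p w h T α β γ ⟩
        (T ⊗ β) ⊗ (p ⊗ h)               ≡⟨ cancel-p⊗h (T ⊗ β) ⟩
        T ⊗ β                           ∎
        where open ≡-Reasoning

      α′-of-dilate : α ⊕ (β ⊕ γ) ≡ 1F → α′ (T ⊗ Y₁) (T ⊗ Y₂) ≡ T ⊗ α
      α′-of-dilate α+β+γ≡1 = begin
        T ⊖ (β′ (T ⊗ Y₁) (T ⊗ Y₂) ⊕ γ′ (T ⊗ Y₁) (T ⊗ Y₂))
          ≡⟨ cong₂ (λ b g → T ⊖ (b ⊕ g)) β′-of-dilate γ′-of-dilate ⟩
        T ⊖ ((T ⊗ β) ⊕ (T ⊗ γ))
          ≡⟨ cong (_⊖ ((T ⊗ β) ⊕ (T ⊗ γ))) (⊗-identityʳ T) ⟨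
        (T ⊗ 1F) ⊖ ((T ⊗ β) ⊕ (T ⊗ γ))
          ≡⟨ cong (λ e → (T ⊗ e) ⊖ ((T ⊗ β) ⊕ (T ⊗ γ))) α+β+γ≡1 ⟨
        (T ⊗ (α ⊕ (β ⊕ γ))) ⊖ ((T ⊗ β) ⊕ (T ⊗ γ))
          ≡⟨ solve 4 (λ T α β γ → (T :* (α :+ (β :+ γ))) :- ((T :* β) :+ (T :* γ)) := T :* α) refl T α β γ ⟩
        T ⊗ α ∎
        where open ≡-Reasoning

    InDilate⇒nonNeg : ∀ {X₁ X₂} → InDilate t Δ (X₁ , X₂) →
      NonNeg (α′ X₁ X₂) × NonNeg (β′ X₁ X₂) × NonNeg (γ′ X₁ X₂)
    InDilate⇒nonNeg (_ , (α , β , γ , 0≤α , 0≤β , 0≤γ , α+β+γ≡1 , refl) , refl) =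
      subst NonNeg (sym (α′-of-dilate α β γ α+β+γ≡1)) (NonNeg-scale α 0<t′ 0≤α) ,
      subst NonNeg (sym (β′-of-dilate α β γ)) (NonNeg-scale β 0<t′ 0≤β) ,
      subst NonNeg (sym (γ′-of-dilate α β γ)) (NonNeg-scale γ 0<t′ 0≤γ)

    module _ (X₁ X₂ : QF) where

      private
        α β γ : QF
        α = T⁻¹ ⊗ α′ X₁ X₂
        β = T⁻¹ ⊗ β′ X₁ X₂
        γ = T⁻¹ ⊗ γ′ X₁ X₂

      α+β+γ≡1 : α ⊕ (β ⊕ γ) ≡ 1F
      α+β+γ≡1 = trans (solve 4 (λ S T b g → (S :* (T :- (b :+ g))) :+ ((S :* b) :+ (S :* g)) := S :* T)
                         refl T⁻¹ T (β′ X₁ X₂) (γ′ X₁ X₂))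
                      (trans (⊗-comm T⁻¹ T) T⊗T⁻¹≡1)

      first-coordinate : (α ⊗ 0F) ⊕ ((β ⊗ p) ⊕ (γ ⊗ w)) ≡ T⁻¹ ⊗ X₁
      first-coordinate = begin
        (α ⊗ 0F) ⊕ ((β ⊗ p) ⊕ (γ ⊗ w))
          ≡⟨ solve 7 (λ S a p w h X₁ X₂ →
               ((S :* a) :* con (+ 0)) :+ (((S :* ((h :* X₁) :- (w :* X₂))) :* p) :+ ((S :* (p :* X₂)) :* w))
               := (S :* X₁) :* (p :* h)) refl T⁻¹ (α′ X₁ X₂) p w h X₁ X₂ ⟩
        (T⁻¹ ⊗ X₁) ⊗ (p ⊗ h) ≡⟨ cancel-p⊗h (T⁻¹ ⊗ X₁) ⟩
        T⁻¹ ⊗ X₁             ∎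
        where open ≡-Reasoning

      second-coordinate : (α ⊗ 0F) ⊕ ((β ⊗ 0F) ⊕ (γ ⊗ h)) ≡ T⁻¹ ⊗ X₂
      second-coordinate = begin
        (α ⊗ 0F) ⊕ ((β ⊗ 0F) ⊕ (γ ⊗ h))
          ≡⟨ solve 6 (λ S a b p h X₂ →
               ((S :* a) :* con (+ 0)) :+ (((S :* b) :* con (+ 0)) :+ ((S :* (p :* X₂)) :* h))
               := (S :* X₂) :* (p :* h)) refl T⁻¹ (α′ X₁ X₂) (β′ X₁ X₂) p h X₂ ⟩
        (T⁻¹ ⊗ X₂) ⊗ (p ⊗ h) ≡⟨ cancel-p⊗h (T⁻¹ ⊗ X₂) ⟩
        T⁻¹ ⊗ X₂             ∎
        where open ≡-Reasoning

      nonNeg⇒InDilate : NonNeg (α′ X₁ X₂) × NonNeg (β′ X₁ X₂) × NonNeg (γ′ X₁ X₂) →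
        InDilate t Δ (X₁ , X₂)
      nonNeg⇒InDilate (0≤α′ , 0≤β′ , 0≤γ′) =
        (T⁻¹ ⊗ X₁ , T⁻¹ ⊗ X₂) ,
        (α , β , γ ,
         NonNeg-scale _ 0<t⁻¹ 0≤α′ , NonNeg-scale _ 0<t⁻¹ 0≤β′ , NonNeg-scale _ 0<t⁻¹ 0≤γ′ ,
         α+β+γ≡1 , cong₂ _,_ (sym first-coordinate) (sym second-coordinate)) ,
        cong₂ _,_ (sym (T⊗T⁻¹⊗ X₁)) (sym (T⊗T⁻¹⊗ X₂))
        where
        0<t⁻¹ = invℚ-pos 0<t′
        T⊗T⁻¹⊗ : ∀ X → T ⊗ (T⁻¹ ⊗ X) ≡ X
        T⊗T⁻¹⊗ X = trans (sym (⊗-assoc T T⁻¹ X)) (trans (cong (_⊗ X) T⊗T⁻¹≡1) (⊗-identityˡ X))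

    InDilate⇔ : ∀ X₁ X₂ →
      InDilate t Δ (X₁ , X₂) ⇔ (NonNeg (α′ X₁ X₂) × NonNeg (β′ X₁ X₂) × NonNeg (γ′ X₁ X₂))
    InDilate⇔ X₁ X₂ = mk⇔ InDilate⇒nonNeg (nonNeg⇒InDilate X₁ X₂)

module LatticePoints (a b c : ℕ) (q : ℤ) (0<a : 0 ℕ.< a) where

  open import Data.Integer using (+_; 0ℤ)
  import Data.Integer.Properties as ℤP
  open import Data.Rational using (0ℚ; 1ℚ; _+_; _*_; _-_; -_; _≤_; _<_)
  import Data.Rational.Properties as ℚP
  open import Data.Product.Function.NonDependent.Propositional using (_×-⇔_)
  open import Tactic.RingSolver using (solve-∀; solve)
  open import Data.List using (_∷_; [])
  open RationalEmbedding
  open QuadraticIntegers using (NonNegℤ√)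

  open Triangles a b c q
  open QuadraticField (Dof a)
    hiding (InDilate; InTriangle; NonNeg; emb; inv; latticePt; Pt; _⊗_; _⊕_; ⊝_; _·_; _+ₚ_; _≤ₖ_)
  open Barycentric (Dof a) using (module DilatedTriangle)

  fromℤ-*₃ : ∀ i j k → fromℤ (i ℤ.* j ℤ.* k) ≡ fromℤ i * fromℤ j * fromℤ k
  fromℤ-*₃ i j k = trans (fromℤ-* (i ℤ.* j) k) (cong (_* fromℤ k) (fromℤ-* i j))

  U : ℤ → ℤ → ℤ
  U x y = + a ℤ.* + a ℤ.* x ℤ.- (+ a ℤ.* q ℤ.- + 1) ℤ.* y

  fromℤ-U : ∀ x y → fromℤ (U x y) ≡ A * A * fromℤ x - aq-1 * fromℤ y
  fromℤ-U x y = trans (fromℤ-- (+ a ℤ.* + a ℤ.* x) ((+ a ℤ.* q ℤ.- + 1) ℤ.* y))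
                      (cong₂ _-_ (fromℤ-*₃ (+ a) (+ a) x) (fromℤ-* (+ a ℤ.* q ℤ.- + 1) y))

  0<A : 0ℚ < A
  0<A = fromℤ-mono-< (ℤ.+<+ 0<a)

  NonNeg-emb-fromℤ : ∀ z → NonNeg (emb (fromℤ z)) ⇔ 0ℤ ℤ.≤ z
  NonNeg-emb-fromℤ z = ⇔.trans (NonNeg-emb (fromℤ z)) (mk⇔ fromℤ-cancel-≤ fromℤ-mono-≤)

  NonNeg-emb-scaled : ∀ {r s s′} z → 0ℚ < s → 0ℚ < s′ → s * r ≡ s′ * fromℤ z →
    NonNeg (emb r) ⇔ 0ℤ ℤ.≤ z
  NonNeg-emb-scaled {r} {s} {s′} z 0<s 0<s′ s*r≡s′*z =
    ⇔.trans (⇔.sym (NonNeg-scale⇔ (emb r) 0<s))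
      (subst (λ X → NonNeg X ⇔ 0ℤ ℤ.≤ z)
             (trans (emb-⊗ s′ (fromℤ z)) (trans (cong emb (sym s*r≡s′*z)) (sym (emb-⊗ s r))))
             (⇔.trans (NonNeg-scale⇔ (emb (fromℤ z)) 0<s′) (NonNeg-emb-fromℤ z)))

  private
    open ≡-Reasoning

    Δn-vertex-product : ∀ A B C iAB iC → (A * B) * iAB ≡ 1ℚ → C * iC ≡ 1ℚ → (C * iAB) * (A * B * iC) ≡ 1ℚ
    Δn-vertex-product A B C iAB iC AB*iAB≡1 C*iC≡1 = begin
      (C * iAB) * (A * B * iC)     ≡⟨ solve (A ∷ B ∷ C ∷ iAB ∷ iC ∷ []) ℚ-ring ⟩
      ((A * B) * iAB) * (C * iC)   ≡⟨ cong₂ _*_ AB*iAB≡1 C*iC≡1 ⟩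
      1ℚ * 1ℚ                      ≡⟨⟩
      1ℚ                           ∎

    Δn-β-numerator : ∀ A B C iC iAC K X Y → C * iC ≡ 1ℚ → (A * C) * iAC ≡ 1ℚ →
      (A * C) * (A * B * iC * X - K * B * iAC * Y) ≡ B * (A * A * X - K * Y)
    Δn-β-numerator A B C iC iAC K X Y C*iC≡1 AC*iAC≡1 = begin
      (A * C) * (A * B * iC * X - K * B * iAC * Y)
        ≡⟨ solve (A ∷ B ∷ C ∷ iC ∷ iAC ∷ K ∷ X ∷ Y ∷ []) ℚ-ring ⟩
      B * (A * A * X * (C * iC) - K * Y * ((A * C) * iAC))
        ≡⟨ cong₂ (λ e f → B * (A * A * X * e - K * Y * f)) C*iC≡1 AC*iAC≡1 ⟩
      B * (A * A * X * 1ℚ - K * Y * 1ℚ)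
        ≡⟨ solve (A ∷ B ∷ K ∷ X ∷ Y ∷ []) ℚ-ring ⟩
      B * (A * A * X - K * Y) ∎

    Δn-α-numerator : ∀ A B C iAB iC iAC K T X Y → (A * B) * iAB ≡ 1ℚ → C * iC ≡ 1ℚ → (A * C) * iAC ≡ 1ℚ →
      (A * B * C) * (T - ((A * B * iC * X - K * B * iAC * Y) + C * iAB * Y))
        ≡ 1ℚ * (T * A * B * C - (A * A * X - K * Y) * B * B - Y * C * C)
    Δn-α-numerator A B C iAB iC iAC K T X Y AB*iAB≡1 C*iC≡1 AC*iAC≡1 = begin
      (A * B * C) * (T - ((A * B * iC * X - K * B * iAC * Y) + C * iAB * Y))
        ≡⟨ solve (A ∷ B ∷ C ∷ iAB ∷ iC ∷ iAC ∷ K ∷ T ∷ X ∷ Y ∷ []) ℚ-ring ⟩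
      T * A * B * C - (A * A * X * (C * iC) - K * Y * ((A * C) * iAC)) * B * B - Y * C * C * ((A * B) * iAB)
        ≡⟨ cong₃ (λ e f g → T * A * B * C - (A * A * X * e - K * Y * f) * B * B - Y * C * C * g)
                 C*iC≡1 AC*iAC≡1 AB*iAB≡1 ⟩
      T * A * B * C - (A * A * X * 1ℚ - K * Y * 1ℚ) * B * B - Y * C * C * 1ℚ
        ≡⟨ solve (A ∷ B ∷ C ∷ K ∷ T ∷ X ∷ Y ∷ []) ℚ-ring ⟩
      1ℚ * (T * A * B * C - (A * A * X - K * Y) * B * B - Y * C * C) ∎
      where
      cong₃ : ∀ {x x′ y y′ z z′} (f : ℚ → ℚ → ℚ → ℚ) →
        x ≡ x′ → y ≡ y′ → z ≡ z′ → f x y z ≡ f x′ y′ z′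
      cong₃ f refl refl refl = refl

  module Δn-lattice (t : ℕ) (0<t : 0 ℕ.< t) (n : ℕ)
                    (0<b : 0ℤ ℤ.< bSeq (+ a) (+ b) (+ c) n) (0<c : 0ℤ ℤ.< cSeq (+ a) (+ b) (+ c) n) where

    private
      B C : ℤ
      B = bSeq (+ a) (+ b) (+ c) n
      C = cSeq (+ a) (+ b) (+ c) n
      0<Bq = fromℤ-mono-< 0<b
      0<Cq = fromℤ-mono-< 0<c
      0<AB = *-pos 0<A 0<Bq
      0<AC = *-pos 0<A 0<Cq

    PN : ℤ → ℤ → ℤ
    PN x y = + t ℤ.* + a ℤ.* B ℤ.* C ℤ.- U x y ℤ.* B ℤ.* B ℤ.- y ℤ.* C ℤ.* C

    fromℤ-PN : ∀ x y → fromℤ (PN x y)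
      ≡ fromℤ (+ t) * A * bn n * cn n - (A * A * fromℤ x - aq-1 * fromℤ y) * bn n * bn n - fromℤ y * cn n * cn n
    fromℤ-PN x y =
      trans (fromℤ-- (+ t ℤ.* + a ℤ.* B ℤ.* C ℤ.- U x y ℤ.* B ℤ.* B) (y ℤ.* C ℤ.* C))
        (cong₂ _-_ (trans (fromℤ-- (+ t ℤ.* + a ℤ.* B ℤ.* C) (U x y ℤ.* B ℤ.* B))
                      (cong₂ _-_ (trans (fromℤ-* (+ t ℤ.* + a ℤ.* B) C) (cong (_* cn n) (fromℤ-*₃ (+ t) (+ a) B)))
                                 (trans (fromℤ-*₃ (U x y) B B) (cong (λ u → u * bn n * bn n) (fromℤ-U x y)))))
                   (fromℤ-*₃ y C C))

    private
      p w h : ℚ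
      p = cn n * invℚ (A * bn n)
      w = aq-1 * bn n * invℚ (A * cn n)
      h = A * bn n * invℚ (cn n)

      p⊗h≡1 : emb p ⊗ emb h ≡ 1F
      p⊗h≡1 = trans (emb-⊗ p h)
        (cong emb (Δn-vertex-product A (bn n) (cn n) _ _ (invℚ-inverseʳ (>⇒≢0 0<AB)) (invℚ-inverseʳ (>⇒≢0 0<Cq))))

    open DilatedTriangle (emb p) (emb w) (emb h) p⊗h≡1 t 0<t

    Δn-lattice⇔ : ∀ x y →
      InDilate t (Δn n) (latticePt x y) ⇔ (0ℤ ℤ.≤ PN x y × 0ℤ ℤ.≤ U x y × 0ℤ ℤ.≤ y)
    Δn-lattice⇔ x y = ⇔.trans (InDilate⇔ X₁ X₂) (α-condition ×-⇔ (β-condition ×-⇔ γ-condition))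
      where
      X₁ X₂ : QF
      X₁ = emb (fromℤ x)
      X₂ = emb (fromℤ y)
      β′≡ : β′ X₁ X₂ ≡ emb (h * fromℤ x - w * fromℤ y)
      β′≡ = cong₂ _⊖_ (emb-⊗ h (fromℤ x)) (emb-⊗ w (fromℤ y))
      α′≡ : α′ X₁ X₂ ≡ emb (fromℤ (+ t) - ((h * fromℤ x - w * fromℤ y) + p * fromℤ y))
      α′≡ = cong (λ z → emb (fromℤ (+ t)) ⊖ z) (cong₂ _⊕_ β′≡ (emb-⊗ p (fromℤ y)))
      γ-condition : NonNeg (γ′ X₁ X₂) ⇔ 0ℤ ℤ.≤ y
      γ-condition = ⇔.trans (NonNeg-scale⇔ X₂ (*-pos 0<Cq (invℚ-pos 0<AB))) (NonNeg-emb-fromℤ y)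
      β-condition : NonNeg (β′ X₁ X₂) ⇔ 0ℤ ℤ.≤ U x y
      β-condition = subst (λ z → NonNeg z ⇔ 0ℤ ℤ.≤ U x y) (sym β′≡)
        (NonNeg-emb-scaled (U x y) 0<AC 0<Bq
          (trans (Δn-β-numerator A (bn n) (cn n) _ _ aq-1 (fromℤ x) (fromℤ y)
                                 (invℚ-inverseʳ (>⇒≢0 0<Cq)) (invℚ-inverseʳ (>⇒≢0 0<AC)))
                 (cong (bn n *_) (sym (fromℤ-U x y)))))
      α-condition : NonNeg (α′ X₁ X₂) ⇔ 0ℤ ℤ.≤ PN x y
      α-condition = subst (λ z → NonNeg z ⇔ 0ℤ ℤ.≤ PN x y) (sym α′≡)
        (NonNeg-emb-scaled (PN x y) (*-pos 0<AB 0<Cq) (fromℤ-mono-< {+ 0} {+ 1} (ℤ.+<+ (s≤s z≤n)))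
          (trans (Δn-α-numerator A (bn n) (cn n) _ _ _ aq-1 (fromℤ (+ t)) (fromℤ x) (fromℤ y)
                                 (invℚ-inverseʳ (>⇒≢0 0<AB)) (invℚ-inverseʳ (>⇒≢0 0<Cq))
                                 (invℚ-inverseʳ (>⇒≢0 0<AC)))
                 (cong (1ℚ *_) (sym (fromℤ-PN x y)))))

  DZ : ℤ
  DZ = + 9 ℤ.* + a ℤ.* + a ℤ.- + 4

  D≡ : Dof a ≡ fromℤ DZ
  D≡ = cong (λ z → fromℤ (z ℤ.- + 4)) (trans (ℤP.pos-* (9 ℕ.* a) a) (cong (ℤ._* + a) (ℤP.pos-* 9 a)))

  NonNeg-pair-scaled : ∀ {s} P R → 0ℚ < s → NonNeg (s * fromℤ P , s * fromℤ R) ⇔ NonNegℤ√ DZ P R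
  NonNeg-pair-scaled {s} P R 0<s =
    subst (λ z → NonNeg z ⇔ NonNegℤ√ DZ P R) (emb-⊗-pair s (fromℤ P) (fromℤ R))
          (⇔.trans (NonNeg-scale⇔ (fromℤ P , fromℤ R) 0<s) (NonNeg-fromℤ {DZ} D≡ P R))

  private
    c₀ : ℚ
    c₀ = fromℤ (+ 3) * invℚ (fromℤ (+ 2))

    Δ∞-conjugate₁ : ∀ D A i → D ≡ fromℤ (+ 9) * A * A - fromℤ (+ 4) → (fromℤ (+ 2) * A) * i ≡ 1ℚ →
      (A * A * c₀ + D * 0ℚ * i) * c₀ + D * (A * A * i + 0ℚ * c₀) * (- i) ≡ 1ℚ
    Δ∞-conjugate₁ _ A i refl 2Ai≡1 = begin
      (A * A * c₀ + (fromℤ (+ 9) * A * A - fromℤ (+ 4)) * 0ℚ * i) * c₀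
        + (fromℤ (+ 9) * A * A - fromℤ (+ 4)) * (A * A * i + 0ℚ * c₀) * (- i)
        ≡⟨ solve (A ∷ i ∷ []) ℚ-ring ⟩
      c₀ * c₀ * A * A * (1ℚ - ((fromℤ (+ 2) * A) * i) * ((fromℤ (+ 2) * A) * i))
        + ((fromℤ (+ 2) * A) * i) * ((fromℤ (+ 2) * A) * i)
        ≡⟨ cong (λ e → c₀ * c₀ * A * A * (1ℚ - e * e) + e * e) 2Ai≡1 ⟩
      c₀ * c₀ * A * A * (1ℚ - 1ℚ * 1ℚ) + 1ℚ * 1ℚ
        ≡⟨ solve (A ∷ []) ℚ-ring ⟩
      1ℚ ∎

    Δ∞-conjugate₂ : ∀ D A i → (A * A * c₀ + D * 0ℚ * i) * (- i) + (A * A * i + 0ℚ * c₀) * c₀ ≡ 0ℚ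
    Δ∞-conjugate₂ = solve-∀ ℚ-ring

    three-halves : ∀ A i r → (fromℤ (+ 2) * A) * i ≡ 1ℚ → r * c₀ ≡ i * (fromℤ (+ 3) * A * r)
    three-halves A i r 2Ai≡1 = begin
      r * c₀                          ≡⟨ solve (r ∷ []) ℚ-ring ⟩
      r * c₀ * 1ℚ                     ≡⟨ cong (r * c₀ *_) 2Ai≡1 ⟨
      r * c₀ * ((fromℤ (+ 2) * A) * i) ≡⟨ solve (A ∷ i ∷ r ∷ []) ℚ-ring ⟩
      i * (fromℤ (+ 3) * A * r)       ∎

    Δ∞-α-numerator : ∀ A i T P₁ P₂ → (fromℤ (+ 2) * A) * i ≡ 1ℚ →
      T - (i * (fromℤ (+ 3) * A * P₁) + i * (fromℤ (+ 3) * A * P₂))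
        ≡ i * (fromℤ (+ 2) * A * T - fromℤ (+ 3) * A * (P₁ + P₂))
    Δ∞-α-numerator A i T P₁ P₂ 2Ai≡1 = begin
      T - (i * (fromℤ (+ 3) * A * P₁) + i * (fromℤ (+ 3) * A * P₂))
        ≡⟨ cong (λ e → e - (i * (fromℤ (+ 3) * A * P₁) + i * (fromℤ (+ 3) * A * P₂)))
                (trans (sym (ℚP.*-identityʳ T)) (cong (T *_) (sym 2Ai≡1))) ⟩
      T * ((fromℤ (+ 2) * A) * i) - (i * (fromℤ (+ 3) * A * P₁) + i * (fromℤ (+ 3) * A * P₂))
        ≡⟨ solve (A ∷ i ∷ T ∷ P₁ ∷ P₂ ∷ []) ℚ-ring ⟩
      i * (fromℤ (+ 2) * A * T - fromℤ (+ 3) * A * (P₁ + P₂)) ∎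

    swap-neg : ∀ r s → r * - s ≡ s * - r
    swap-neg = solve-∀ ℚ-ring

    Δ∞-α-conjugate : ∀ i R₁ R₂ → 0ℚ + - (i * (- R₁) + i * R₂) ≡ i * (R₁ - R₂)
    Δ∞-α-conjugate = solve-∀ ℚ-ring

  module Δ∞-lattice (t : ℕ) (0<t : 0 ℕ.< t) where

    P∞ : ℤ → ℤ → ℤ
    P∞ x y = + 2 ℤ.* + a ℤ.* + t ℤ.- + 3 ℤ.* + a ℤ.* (U x y ℤ.+ y)

    private
      i : ℚ
      i = invℚ (fromℤ (+ 2) * A)

      0<2A : 0ℚ < fromℤ (+ 2) * A
      0<2A = *-pos (fromℤ-mono-< {+ 0} {+ 2} (ℤ.+<+ (s≤s z≤n))) 0<A

      2Ai≡1 : (fromℤ (+ 2) * A) * i ≡ 1ℚ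
      2Ai≡1 = invℚ-inverseʳ (>⇒≢0 0<2A)

      D≡ℚ : Dof a ≡ fromℤ (+ 9) * A * A - fromℤ (+ 4)
      D≡ℚ = trans D≡ (trans (fromℤ-- (+ 9 ℤ.* + a ℤ.* + a) (+ 4))
                            (cong (_- fromℤ (+ 4)) (fromℤ-*₃ (+ 9) (+ a) (+ a))))

      -- λ = c₀ + i√D with c₀ = 3/2 and i = 1/(2a), and (a²λ)⁻¹ is its conjugate 3 − λ = c₀ − i√D
      -- because λ (3 − λ) = (9 − D/a²)/4 = 1/a².
      μ μ′ : QF
      μ  = inv (emb (A * A) ⊗ lam)
      μ′ = c₀ , - i

      a²λ⊗μ′≡1 : (emb (A * A) ⊗ lam) ⊗ μ′ ≡ 1F
      a²λ⊗μ′≡1 = cong₂ _,_ (Δ∞-conjugate₁ (Dof a) A i D≡ℚ 2Ai≡1) (Δ∞-conjugate₂ (Dof a) A i)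

      μ≡μ′ : μ ≡ μ′
      μ≡μ′ = inv-unique (emb (A * A) ⊗ lam) μ′ a²λ⊗μ′≡1

      p⊗h≡1 : lam ⊗ (μ ⊗ emb (A * A)) ≡ 1F
      p⊗h≡1 = trans (QF-Solver.solve 3 (λ l m e → l :* (m :* e) := (e :* l) :* m) refl lam μ (emb (A * A)))
                    (trans (cong ((emb (A * A) ⊗ lam) ⊗_) μ≡μ′) a²λ⊗μ′≡1)
        where open QF-Solver using (_:*_; _:=_)

    open DilatedTriangle lam (μ ⊗ emb aq-1) (μ ⊗ emb (A * A)) p⊗h≡1 t 0<t

    module _ (x y : ℤ) where

      private
        X Y Uq : ℚ
        X  = fromℤ x
        Y  = fromℤ y
        Uq = fromℤ (U x y)

      fromℤ-P∞ : fromℤ (P∞ x y) ≡ fromℤ (+ 2) * A * fromℤ (+ t) - fromℤ (+ 3) * A * (Uq + Y)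
      fromℤ-P∞ = trans (fromℤ-- (+ 2 ℤ.* + a ℤ.* + t) (+ 3 ℤ.* + a ℤ.* (U x y ℤ.+ y)))
        (cong₂ _-_ (fromℤ-*₃ (+ 2) (+ a) (+ t))
                   (trans (fromℤ-* (+ 3 ℤ.* + a) (U x y ℤ.+ y))
                          (cong₂ _*_ (fromℤ-* (+ 3) (+ a)) (fromℤ-+ (U x y) y))))

      γ′≡ : γ′ (emb X) (emb Y) ≡ (i * (fromℤ (+ 3) * A * Y) , i * Y)
      γ′≡ = trans (pair-⊗-emb Y c₀ i) (cong₂ _,_ (three-halves A i Y 2Ai≡1) (ℚP.*-comm Y i))

      β′≡ : β′ (emb X) (emb Y) ≡ (i * (fromℤ (+ 3) * A * Uq) , i * (- Uq))
      β′≡ = begin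
        ((μ ⊗ emb (A * A)) ⊗ emb X) ⊖ ((μ ⊗ emb aq-1) ⊗ emb Y)
          ≡⟨ QF-Solver.solve 5 (λ m e k x y → ((m :* e) :* x) :- ((m :* k) :* y) := m :* ((e :* x) :- (k :* y)))
                               refl μ (emb (A * A)) (emb aq-1) (emb X) (emb Y) ⟩
        μ ⊗ ((emb (A * A) ⊗ emb X) ⊖ (emb aq-1 ⊗ emb Y))
          ≡⟨ cong₂ _⊗_ μ≡μ′ (cong₂ _⊖_ (emb-⊗ (A * A) X) (emb-⊗ aq-1 Y)) ⟩
        μ′ ⊗ emb (A * A * X - aq-1 * Y)
          ≡⟨ cong (λ r → μ′ ⊗ emb r) (sym (fromℤ-U x y)) ⟩
        μ′ ⊗ emb Uq
          ≡⟨ pair-⊗-emb Uq c₀ (- i) ⟩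
        (Uq * c₀ , Uq * - i)
          ≡⟨ cong₂ _,_ (three-halves A i Uq 2Ai≡1) (swap-neg Uq i) ⟩
        (i * (fromℤ (+ 3) * A * Uq) , i * (- Uq)) ∎
        where open QF-Solver using (_:*_; _:-_; _:=_)

      α′≡ : α′ (emb X) (emb Y) ≡ (i * (fromℤ (+ 2) * A * fromℤ (+ t) - fromℤ (+ 3) * A * (Uq + Y)) , i * (Uq - Y))
      α′≡ = trans (cong (λ z → emb (fromℤ (+ t)) ⊖ z) (cong₂ _⊕_ β′≡ γ′≡))
                  (cong₂ _,_ (Δ∞-α-numerator A i (fromℤ (+ t)) Uq Y 2Ai≡1) (Δ∞-α-conjugate i Uq Y))

    private
      condition : ∀ P R {z P′ R′} → z ≡ (i * P′ , i * R′) → fromℤ P ≡ P′ → fromℤ R ≡ R′ →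
        NonNeg z ⇔ NonNegℤ√ DZ P R
      condition P R refl refl refl = NonNeg-pair-scaled P R (invℚ-pos 0<2A)

    Δ∞-lattice⇔ : ∀ x y → InDilate t Δ∞ (latticePt x y)
      ⇔ (NonNegℤ√ DZ (P∞ x y) (U x y ℤ.- y) × NonNegℤ√ DZ (+ 3 ℤ.* + a ℤ.* U x y) (ℤ.- U x y)
                                                × NonNegℤ√ DZ (+ 3 ℤ.* + a ℤ.* y) y)
    Δ∞-lattice⇔ x y = ⇔.trans (InDilate⇔ (emb (fromℤ x)) (emb (fromℤ y)))
      (condition (P∞ x y) (U x y ℤ.- y) (α′≡ x y) (fromℤ-P∞ x y) (fromℤ-- (U x y) y)
       ×-⇔ (condition (+ 3 ℤ.* + a ℤ.* U x y) (ℤ.- U x y) (β′≡ x y)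
                      (fromℤ-*₃ (+ 3) (+ a) (U x y)) (fromℤ-neg (U x y))
       ×-⇔ condition (+ 3 ℤ.* + a ℤ.* y) y (γ′≡ x y) (fromℤ-*₃ (+ 3) (+ a) y) refl))

open import Data.Nat using (ℕ; _≤_)
open import Data.Integer using (ℤ; +_; _*_; _-_)
open import Data.Integer.Divisibility using (_∣_)
open import Data.Product using (Σ; _×_)
open import Function.Bundles using (_⇔_)

import Data.Integer.Properties as ℤP

private
  ×-⇔-under : ∀ {P P′ Q Q′ R R′ : Set} →
    Q ⇔ Q′ → R ⇔ R′ → (Q′ → R′ → P ⇔ P′) → (P × Q × R) ⇔ (P′ × Q′ × R′)
  ×-⇔-under {P} {P′} {Q} {Q′} {R} {R′} Q⇔Q′ R⇔R′ P⇔P′ = mk⇔ forward backward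
    where
    open Function.Bundles.Equivalence
    forward : P × Q × R → P′ × Q′ × R′
    forward (p , q , r) = to (P⇔P′ (to Q⇔Q′ q) (to R⇔R′ r)) p , to Q⇔Q′ q , to R⇔R′ r
    backward : P′ × Q′ × R′ → P × Q × R
    backward (p′ , q′ , r′) = from (P⇔P′ q′ r′) p′ , from Q⇔Q′ q′ , from R⇔R′ r′

  3a⁴t-cast : ∀ a t → + (3 ℕ.* (a ℕ.* a) ℕ.* (a ℕ.* a) ℕ.* t) ≡ + 3 * (+ a * + a) * (+ a * + a) * + t
  3a⁴t-cast a t =
    trans (ℤP.pos-* (3 ℕ.* (a ℕ.* a) ℕ.* (a ℕ.* a)) t)
      (cong (_* + t) (trans (ℤP.pos-* (3 ℕ.* (a ℕ.* a)) (a ℕ.* a))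
                            (cong₂ _*_ (trans (ℤP.pos-* 3 (a ℕ.* a)) (cong (+ 3 *_) (ℤP.pos-* a a)))
                                       (ℤP.pos-* a a))))

mainTheorem8 :
    (b a c : ℕ) → IsMarkovTriple b a c → b ≤ a → c ≤ a →
    (q : ℤ) → (+ a) ∣ (q * (+ b) - (+ 3) * (+ c)) →
    (t : ℕ) → Σ ℕ λ Nt → (n : ℕ) → Nt ≤ n → (x y : ℤ) →
      (Triangles.InDilate a b c q t (Triangles.Δ∞ a b c q) (Triangles.latticePt a b c q x y)
        ⇔ Triangles.InDilate a b c q t (Triangles.Δn a b c q n) (Triangles.latticePt a b c q x y))
mainTheorem8 b a c markov b≤a _ q _ zero = 0 , λ n _ x y → mk⇔ (InDilate-zero _ _ _) (InDilate-zero _ _ _)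
  where open Barycentric (Dof a)
mainTheorem8 b a c markov@(_ , 0<a , _) b≤a _ q _ t@(suc _) = suc K , agree
  where
  K : ℕ
  K = 3 ℕ.* (a ℕ.* a) ℕ.* (a ℕ.* a) ℕ.* t
  open Triangles a b c q using (InDilate; Δ∞; Δn; latticePt)
  open LatticePoints a b c q 0<a
  open MarkovSequence a b c b≤a markov
  open QuadraticIntegers
  agree : ∀ n → suc K ≤ n → ∀ x y → InDilate t Δ∞ (latticePt x y) ⇔ InDilate t (Δn n) (latticePt x y)
  agree (suc k) (s≤s K≤k) x y =
    ⇔.trans (Δ∞-lattice⇔ x y)
      (⇔.trans (×-⇔-under (nonNeg√[3a-√D] (U x y)) (nonNeg√[3a+√D] y) same-third-condition)
               (⇔.sym (Δn-lattice⇔ x y)))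
    where
    open Δ∞-lattice t (s≤s z≤n)
    open Δn-lattice t (s≤s z≤n) (suc k) (0<B (suc k)) (0<C (suc k))
    open Conjugates (+ a) (ℤ.+≤+ 0<a)
    large : + 3 * (+ a * + a) * (+ a * + a) * + t ℤ.< B (suc k)
    large = subst (ℤ._< B (suc k)) (3a⁴t-cast a t) (ℤP.≤-<-trans (ℤ.+≤+ K≤k) (n<B k))
    same-third-condition : ℤ.0ℤ ℤ.≤ U x y → ℤ.0ℤ ℤ.≤ y →
      NonNegℤ√ DZ (P∞ x y) (U x y - y) ⇔ ℤ.0ℤ ℤ.≤ PN x y
    same-third-condition 0≤U 0≤y =
      Comparison.nonNeg√⇔nonNeg (+ a) (+ t) (U x y) y (B (suc k)) (C (suc k)) (ℤ.+≤+ 0<a) (ℤ.+≤+ z≤n)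
        0≤U 0≤y (0<B (suc k)) (B≤C k) (markov-invariant (suc k)) large
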